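{- Let $n\geq 5$. If $T$ and $T'$ are two adjacent vertices in $\mathcal{A}_n$, then the edge $TT'$ is contained in at least one and at most four cycles of length $5$ in $\mathcal{A}_n$.
   Context: For $n\geq 4$, let $P$ be a convex $n$-gon. The associahedron graph $\mathcal{A}_n$ has as vertices the triangulations of $P$ (sets of $n-3$ pairwise non-crossing diagonals of $P$), two distinct triangulations being adjacent if they share $n-4$ diagonals. -}

module Defs where

open import Data.Nat using (ℕ; zero; suc; _+_; _∸_; _≤_; _<_)
open import Data.Fin using (Fin; toℕ)
open import Data.Bool using (Bool; true; false)
open import Data.List using (List; map; allFin; length)
open import Data.Nat.ListAction using (sum)
open import Data.List.Relation.Unary.AllPairs using (AllPairs)
open import Data.Product using (_×_; Σ; ∃)
open import Data.Sum using (_⊎_)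
open import Relation.Nullary using (¬_)
open import Relation.Binary.PropositionalEquality using (_≡_)

-- Vertices of the convex n-gon P are labelled 0,…,n-1 in cyclic order (Fin n).
-- A diagonal is encoded by its endpoints (i , j) with i < j.
-- (i , j), i < j, is a diagonal iff i and j are not consecutive on the polygon:
-- j ≥ i + 2 and {i , j} ≠ {0 , n-1}.
IsDiagonal : (n : ℕ) → Fin n → Fin n → Set
IsDiagonal n i j = (toℕ i + 2 ≤ toℕ j) × ¬ ((toℕ i ≡ 0) × (suc (toℕ j) ≡ n))

-- Diagonals (i , j) and (k , l) (with i < j, k < l) cross iff their endpoints interleave.
Cross : {n : ℕ} → Fin n → Fin n → Fin n → Fin n → Set
Cross i j k l =
  ((toℕ i < toℕ k) × (toℕ k < toℕ j) × (toℕ j < toℕ l))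
  ⊎ ((toℕ k < toℕ i) × (toℕ i < toℕ l) × (toℕ l < toℕ j))

DiagSet : ℕ → Set
DiagSet n = Fin n → Fin n → Bool

card : {n : ℕ} → DiagSet n → ℕ
card {n} D = sum (map (λ i → sum (map (λ j → count (D i j)) (allFin n))) (allFin n))
  where
  count : Bool → ℕ
  count true = 1
  count false = 0

_∩_ : {n : ℕ} → DiagSet n → DiagSet n → DiagSet n
(D ∩ E) i j with D i j
... | true = E i j
... | false = false

SameSet : {n : ℕ} → DiagSet n → DiagSet n → Set
SameSet {n} D E = (i j : Fin n) → D i j ≡ E i j

IsTriangulation : (n : ℕ) → DiagSet n → Set
IsTriangulation n T =
  ((i j : Fin n) → T i j ≡ true → IsDiagonal n i j)
  × ((i j k l : Fin n) → T i j ≡ true → T k l ≡ true → ¬ Cross i j k l)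
  × (card T ≡ n ∸ 3)

-- Adjacency in the associahedron graph 𝒜ₙ: two distinct triangulations
-- sharing n-4 diagonals.
Adjacent : (n : ℕ) → DiagSet n → DiagSet n → Set
Adjacent n T U =
  IsTriangulation n T × IsTriangulation n U × ¬ SameSet T U × (card (T ∩ U) ≡ n ∸ 4)

-- A 5-cycle of 𝒜ₙ through the edge T U.  Every such cycle can be written uniquely
-- as T – U – A – B – C – T, so it is encoded by the triple (A , B , C).
record FiveCycleThrough (n : ℕ) (T U : DiagSet n) : Set where
  constructor cyc
  field
    A B C : DiagSet n
    adjUA : Adjacent n U A
    adjAB : Adjacent n A B
    adjBC : Adjacent n B C
    adjCT : Adjacent n C T
    T≢A : ¬ SameSet T A
    T≢B : ¬ SameSet T B
    U≢B : ¬ SameSet U B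
    U≢C : ¬ SameSet U C
    A≢C : ¬ SameSet A C
    -- (the remaining pairs T≠U, U≠A, A≠B, B≠C, C≠T follow from adjacency)

SameCycle : {n : ℕ} {T U : DiagSet n} → FiveCycleThrough n T U → FiveCycleThrough n T U → Set
SameCycle c d =
  SameSet (FiveCycleThrough.A c) (FiveCycleThrough.A d)
  × SameSet (FiveCycleThrough.B c) (FiveCycleThrough.B d)
  × SameSet (FiveCycleThrough.C c) (FiveCycleThrough.C d)

DistinctCycles : {n : ℕ} {T U : DiagSet n} → List (FiveCycleThrough n T U) → Set
DistinctCycles = AllPairs (λ c d → ¬ SameCycle c d)

module Submission where

open import Defs
open import Data.Nat using (ℕ; zero; suc; _+_; _*_; _∸_; _≤_; _<_; z≤n; s≤s; _⊔_; _≤?_; _<?_)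
open import Data.Nat.Properties
open import Data.Nat.ListAction using (sum)
open import Algebra.Properties.CommutativeSemigroup +-commutativeSemigroup using () renaming (interchange to +-interchange)
open import Data.Fin using (Fin; toℕ; fromℕ<) renaming (zero to fz; suc to fs)
import Data.Fin.Properties as FP
open import Data.Bool using (Bool; true; false; _∧_; _∨_; not)
import Data.Bool.Properties as BP
open import Data.List using (List; []; _∷_; length; map; allFin; tabulate; lookup)
open import Data.List.Properties using (map-tabulate; map-cong)
open import Data.List.Relation.Unary.All using (All; []; _∷_)
open import Data.List.Relation.Unary.AllPairs using (AllPairs; []; _∷_)
open import Data.Product using (_×_; _,_; proj₁; proj₂; ∃)
open import Data.Product.Properties using (≡-dec)
open import Data.Sum using (_⊎_; inj₁; inj₂; [_,_]′)
open import Data.Empty using (⊥; ⊥-elim)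
open import Function using (id; _∘_; case_of_)
open import Relation.Nullary using (¬_; Dec; yes; no; does)
open import Relation.Nullary.Decidable using (_×-dec_; _⊎-dec_; _→-dec_; ¬?; dec-true; dec-false; from-yes)
open import Relation.Binary.Definitions using (DecidableEquality; tri<; tri≈; tri>)
open import Relation.Binary.PropositionalEquality

-- T and U differ by a flip: the diagonal d of T is replaced by the diagonal d′ of U, and d, d′
-- are the diagonals of a quadrilateral Q whose sides are chords of S = T ∩ U or sides of the
-- polygon.  Flips are unique (no three triangulations share n - 4 diagonals), and a counting
-- argument shows that a 5-cycle T – U – A – B – C – T flips, right after U, a chord of S that
-- is a side of Q and determines the whole cycle; hence at most four such cycles.  Conversely,
-- as n ≥ 5 some side σ of Q lies in S; the triangle of T on σ outside Q extends Q to a convex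
-- pentagon, and S - σ together with any two consecutive diagonals of this pentagon gives the
-- five triangulations of a 5-cycle through T and U.  Crossing patterns among the few points
-- involved are settled by evaluation, after replacing points by their ranks among them.

module _ {A : Set} where
  all-lookup : {P : A → Set} {xs : List A} → All P xs → (i : Fin (length xs)) → P (lookup xs i)
  all-lookup (px ∷ _) fz = px
  all-lookup (_ ∷ pxs) (fs i) = all-lookup pxs i

  allPairs-lookup : {R : A → A → Set} {xs : List A} → AllPairs R xs →
    ∀ i j → toℕ i < toℕ j → R (lookup xs i) (lookup xs j)
  allPairs-lookup (px ∷ _) fz (fs j) _ = all-lookup px j
  allPairs-lookup (_ ∷ pxs) (fs i) (fs j) (s≤s i<j) = allPairs-lookup pxs i j i<j

  distinct-length≤ : {R : A → A → Set} {k : ℕ} (f : A → Fin k) → (∀ a b → f a ≡ f b → R a b) →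
    (xs : List A) → AllPairs (λ a b → ¬ R a b) xs → length xs ≤ k
  distinct-length≤ {k = k} f f-fibres xs distinct with length xs ≤? k
  ... | yes ≤k = ≤k
  ... | no ≰k with FP.pigeonhole (≰⇒> ≰k) (f ∘ lookup xs)
  ...   | i , j , i<j , eq = ⊥-elim (allPairs-lookup distinct i j i<j (f-fibres _ _ eq))

χ : Bool → ℕ
χ true = 1
χ false = 0

∑ : {n : ℕ} → (Fin n → ℕ) → ℕ
∑ {zero} f = 0
∑ {suc n} f = f fz + ∑ (λ i → f (fs i))

∑-cong : {n : ℕ} {f g : Fin n → ℕ} → (∀ i → f i ≡ g i) → ∑ f ≡ ∑ g
∑-cong {zero} e = refl
∑-cong {suc n} e = cong₂ _+_ (e fz) (∑-cong (λ i → e (fs i)))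

∑-mono : {n : ℕ} {f g : Fin n → ℕ} → (∀ i → f i ≤ g i) → ∑ f ≤ ∑ g
∑-mono {zero} e = z≤n
∑-mono {suc n} e = +-mono-≤ (e fz) (∑-mono (λ i → e (fs i)))

∑-+ : {n : ℕ} (f g : Fin n → ℕ) → ∑ (λ i → f i + g i) ≡ ∑ f + ∑ g
∑-+ {zero} f g = refl
∑-+ {suc n} f g = trans (cong ((f fz + g fz) +_) (∑-+ (λ i → f (fs i)) (λ i → g (fs i))))
  (+-interchange (f fz) (g fz) (∑ (λ i → f (fs i))) (∑ (λ i → g (fs i))))

∑-single : {n : ℕ} (f : Fin n → ℕ) (i₀ : Fin n) → (∀ i → i ≢ i₀ → f i ≡ 0) → ∑ f ≡ f i₀
∑-single {suc n} f fz h = trans (cong (f fz +_) (∑-zero (λ i → h (fs i) (λ ())))) (+-identityʳ _)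
  where
  ∑-zero : {m : ℕ} {g : Fin m → ℕ} → (∀ i → g i ≡ 0) → ∑ g ≡ 0
  ∑-zero {zero} e = refl
  ∑-zero {suc m} e = cong₂ _+_ (e fz) (∑-zero (λ i → e (fs i)))
∑-single {suc n} f (fs i₀) h = trans (cong (_+ ∑ (λ i → f (fs i))) (h fz (λ ())))
  (∑-single (λ i → f (fs i)) i₀ (λ i ne → h (fs i) (λ e → ne (FP.suc-injective e))))

∑-nonzero : {n : ℕ} (f : Fin n → ℕ) → 1 ≤ ∑ f → ∃ λ i → 1 ≤ f i
∑-nonzero {suc n} f h with f fz in e
... | suc k = fz , subst (1 ≤_) (sym e) (s≤s z≤n)
... | zero = let i , p = ∑-nonzero (λ i → f (fs i)) h in fs i , p

sum-allFin : {n : ℕ} (f : Fin n → ℕ) → sum (map f (allFin n)) ≡ ∑ f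
sum-allFin {n} f = trans (cong sum (map-tabulate id f)) (sum-tabulate f)
  where
  sum-tabulate : {m : ℕ} (g : Fin m → ℕ) → sum (tabulate g) ≡ ∑ g
  sum-tabulate {zero} g = refl
  sum-tabulate {suc m} g = cong (g fz +_) (sum-tabulate (λ i → g (fs i)))

∑₂ : {n : ℕ} → (Fin n → Fin n → ℕ) → ℕ
∑₂ f = ∑ (λ i → ∑ (λ j → f i j))

∑₂-cong : {n : ℕ} {f g : Fin n → Fin n → ℕ} → (∀ i j → f i j ≡ g i j) → ∑₂ f ≡ ∑₂ g
∑₂-cong e = ∑-cong (λ i → ∑-cong (e i))

∑₂-+ : {n : ℕ} (f g : Fin n → Fin n → ℕ) → ∑₂ (λ i j → f i j + g i j) ≡ ∑₂ f + ∑₂ g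
∑₂-+ f g = trans (∑-cong (λ i → ∑-+ (f i) (g i))) (∑-+ (λ i → ∑ (f i)) (λ i → ∑ (g i)))

Chord : ℕ → Set
Chord n = Fin n × Fin n

size : {n : ℕ} → DiagSet n → ℕ
size X = ∑₂ (λ i j → χ (X i j))

-- Defs.card counts with a function local to its definition; card on the one-point
-- polygon exposes it, as card {1} (λ _ _ → b) unfolds to (count b + 0) + 0.
χ≡card1 : ∀ b → χ b ≡ card {1} (λ _ _ → b)
χ≡card1 true = refl
χ≡card1 false = refl

card≡size : {n : ℕ} (X : DiagSet n) → card X ≡ size X
card≡size {n} X = trans (cong sum (map-cong row (allFin n))) (sum-allFin (λ i → ∑ λ j → χ (X i j)))
  where
  row = λ i → trans (cong sum (map-cong (λ j → trans (sym (trans (+-identityʳ _) (+-identityʳ _))) (sym (χ≡card1 (X i j)))) (allFin n)))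
                    (sum-allFin (λ j → χ (X i j)))

module _ {n : ℕ} where
  infix 4 _∋_ _⊆_ _≟ᶜ_
  infixl 6 _─_ _⊕_ _∖_

  _∋_ : DiagSet n → Chord n → Set
  X ∋ e = X (proj₁ e) (proj₂ e) ≡ true

  _∈?_ : (e : Chord n) (X : DiagSet n) → Dec (X ∋ e)
  e ∈? X = X (proj₁ e) (proj₂ e) BP.≟ true

  _⊆_ : DiagSet n → DiagSet n → Set
  X ⊆ Y = ∀ i j → X i j ≡ true → Y i j ≡ true

  _≟ᶜ_ : DecidableEquality (Chord n)
  _≟ᶜ_ = ≡-dec FP._≟_ FP._≟_

  _─_ : DiagSet n → Chord n → DiagSet n
  (X ─ e) i j = X i j ∧ not (does ((i , j) ≟ᶜ e))

  _⊕_ : DiagSet n → Chord n → DiagSet n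
  (X ⊕ e) i j = does ((i , j) ≟ᶜ e) ∨ X i j

  _∖_ : DiagSet n → DiagSet n → DiagSet n
  (X ∖ Y) i j = X i j ∧ not (Y i j)

  ∋-subst : {X : DiagSet n} {e f : Chord n} → e ≡ f → X ∋ e → X ∋ f
  ∋-subst refl h = h

  ∩-intro : (X Y : DiagSet n) → ∀ x → X ∋ x → Y ∋ x → (X ∩ Y) ∋ x
  ∩-intro X Y (i , j) hx hy rewrite hx = hy

  ∩-elimˡ : (X Y : DiagSet n) → (X ∩ Y) ⊆ X
  ∩-elimˡ X Y i j h with X i j
  ... | true = refl

  ∩-elimʳ : (X Y : DiagSet n) → (X ∩ Y) ⊆ Y
  ∩-elimʳ X Y i j h with X i j
  ... | true = h

  ─-intro : (X : DiagSet n) (e : Chord n) → ∀ x → X ∋ x → x ≢ e → (X ─ e) ∋ x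
  ─-intro X e (i , j) h ne rewrite h with (i , j) ≟ᶜ e
  ... | yes p = ⊥-elim (ne p)
  ... | no _ = refl

  ─-elim : (X : DiagSet n) (e : Chord n) → (X ─ e) ⊆ X
  ─-elim X e i j h with X i j
  ... | true = refl

  ─-elim≢ : (X : DiagSet n) (e : Chord n) → ∀ i j → (X ─ e) i j ≡ true → (i , j) ≢ e
  ─-elim≢ X e i j h p with X i j | (i , j) ≟ᶜ e
  ... | true | no ¬p = ¬p p

  ⊕-new : (X : DiagSet n) (e : Chord n) → (X ⊕ e) ∋ e
  ⊕-new X e with e ≟ᶜ e
  ... | yes _ = refl
  ... | no ¬p = ⊥-elim (¬p refl)

  ⊕-old : (X : DiagSet n) (e : Chord n) → X ⊆ (X ⊕ e)
  ⊕-old X e i j h rewrite h = BP.∨-zeroʳ _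

  ⊕-elim : (X : DiagSet n) (e : Chord n) → ∀ i j → (X ⊕ e) i j ≡ true → ((i , j) ≡ e) ⊎ (X i j ≡ true)
  ⊕-elim X e i j h with (i , j) ≟ᶜ e
  ... | yes p = inj₁ p
  ... | no _ = inj₂ h

  ∖-intro : (X Y : DiagSet n) → ∀ x → X ∋ x → ¬ (Y ∋ x) → (X ∖ Y) ∋ x
  ∖-intro X Y (i , j) hx hy rewrite hx with Y i j
  ... | true = ⊥-elim (hy refl)
  ... | false = refl

  ∖-elimˡ : (X Y : DiagSet n) → (X ∖ Y) ⊆ X
  ∖-elimˡ X Y i j h with X i j
  ... | true = refl

  ∖-elimʳ : (X Y : DiagSet n) → ∀ i j → (X ∖ Y) i j ≡ true → Y i j ≢ true
  ∖-elimʳ X Y i j h hy rewrite hy with X i j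
  ... | true = case h of λ ()
  ... | false = case h of λ ()

  ⊆-antisym : (X Y : DiagSet n) → X ⊆ Y → Y ⊆ X → SameSet X Y
  ⊆-antisym X Y a b i j with X i j in p | Y i j in q
  ... | true | true = refl
  ... | false | false = refl
  ... | true | false = case trans (sym (a i j p)) q of λ ()
  ... | false | true = case trans (sym (b i j q)) p of λ ()

  same-sym : (X Y : DiagSet n) → SameSet X Y → SameSet Y X
  same-sym X Y s i j = sym (s i j)

  same-trans : (X Y Z : DiagSet n) → SameSet X Y → SameSet Y Z → SameSet X Z
  same-trans X Y Z a b i j = trans (a i j) (b i j)

  ⊕-⊆ : (W Y : DiagSet n) (x : Chord n) → W ⊆ Y → Y ∋ x → (W ⊕ x) ⊆ Y
  ⊕-⊆ W Y x wy yx i j h with ⊕-elim W x i j h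
  ... | inj₁ refl = yx
  ... | inj₂ w = wy i j w

  ∩-comm : (X Y : DiagSet n) → SameSet (X ∩ Y) (Y ∩ X)
  ∩-comm X Y = ⊆-antisym _ _ (λ i j h → ∩-intro Y X (i , j) (∩-elimʳ X Y i j h) (∩-elimˡ X Y i j h))
                             (λ i j h → ∩-intro X Y (i , j) (∩-elimʳ Y X i j h) (∩-elimˡ Y X i j h))

  size-cong : (X Y : DiagSet n) → SameSet X Y → size X ≡ size Y
  size-cong X Y e = ∑₂-cong (λ i j → cong χ (e i j))

  size-mono : (X Y : DiagSet n) → X ⊆ Y → size X ≤ size Y
  size-mono X Y s = ∑-mono (λ i → ∑-mono (λ j → pointwise i j))
    where
    pointwise : ∀ i j → χ (X i j) ≤ χ (Y i j)
    pointwise i j with X i j in p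
    ... | true rewrite s i j p = ≤-refl
    ... | false = z≤n

  size-split : (X Y : DiagSet n) → size X ≡ size (X ∩ Y) + size (X ∖ Y)
  size-split X Y = trans (∑₂-cong pointwise) (∑₂-+ (λ i j → χ ((X ∩ Y) i j)) (λ i j → χ ((X ∖ Y) i j)))
    where
    pointwise : ∀ i j → χ (X i j) ≡ χ ((X ∩ Y) i j) + χ ((X ∖ Y) i j)
    pointwise i j with X i j
    ... | false = refl
    ... | true with Y i j
    ...   | true = refl
    ...   | false = refl

  size-inclusion-exclusion : (R P Q : DiagSet n) → P ⊆ R → Q ⊆ R → size P + size Q ≤ size R + size (P ∩ Q)
  size-inclusion-exclusion R P Q pr qr =
    subst₂ _≤_ (∑₂-+ (λ i j → χ (P i j)) (λ i j → χ (Q i j))) (∑₂-+ (λ i j → χ (R i j)) (λ i j → χ ((P ∩ Q) i j)))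
      (∑-mono (λ i → ∑-mono (λ j → pointwise i j)))
    where
    pointwise : ∀ i j → χ (P i j) + χ (Q i j) ≤ χ (R i j) + χ ((P ∩ Q) i j)
    pointwise i j with P i j in p | Q i j in q
    ... | false | false = z≤n
    ... | true | false rewrite pr i j p = s≤s z≤n
    ... | false | true rewrite qr i j q = s≤s z≤n
    ... | true | true rewrite pr i j p | q = ≤-refl

  size-remove : (X : DiagSet n) (e : Chord n) → X ∋ e → size X ≡ suc (size (X ─ e))
  size-remove X e h = trans (∑₂-cong pointwise) (trans (∑₂-+ (λ i j → χ ((X ─ e) i j)) is-e) (trans (cong (size (X ─ e) +_) singleton) (+-comm _ 1)))
    where
    is-e : Fin n → Fin n → ℕ
    is-e i j = χ (does ((i , j) ≟ᶜ e))
    pointwise : ∀ i j → χ (X i j) ≡ χ ((X ─ e) i j) + is-e i j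
    pointwise i j with (i , j) ≟ᶜ e
    ... | yes refl rewrite h = refl
    ... | no _ with X i j
    ...   | true = refl
    ...   | false = refl
    singleton : ∑₂ is-e ≡ 1
    singleton = trans (∑-single _ (proj₁ e) (λ i ne → trans (∑-cong (λ j → cong χ (dec-false ((i , j) ≟ᶜ e) (ne ∘ cong proj₁))))
                                                               (∑-single _ (proj₂ e) (λ _ _ → refl))))
                      (trans (∑-single _ (proj₂ e) (λ j ne → cong χ (dec-false ((proj₁ e , j) ≟ᶜ e) (ne ∘ cong proj₂))))
                             (cong χ (dec-true (e ≟ᶜ e) refl)))

  size-insert : (X : DiagSet n) (e : Chord n) → ¬ (X ∋ e) → size (X ⊕ e) ≡ suc (size X)
  size-insert X e ∉X = trans (size-remove (X ⊕ e) e (⊕-new X e)) (cong suc (size-cong _ _ (⊆-antisym _ _ ⊆X X⊆)))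
    where
    ⊆X : ((X ⊕ e) ─ e) ⊆ X
    ⊆X i j h with ⊕-elim X e i j (─-elim (X ⊕ e) e i j h)
    ... | inj₁ p = ⊥-elim (─-elim≢ (X ⊕ e) e i j h p)
    ... | inj₂ x = x
    X⊆ : X ⊆ ((X ⊕ e) ─ e)
    X⊆ i j h = ─-intro (X ⊕ e) e (i , j) (⊕-old X e i j h) (λ p → ∉X (∋-subst {X = X} p h))

  nonempty : (X : DiagSet n) → 1 ≤ size X → ∃ λ e → X ∋ e
  nonempty X h with ∑-nonzero _ h
  ... | i , h′ with ∑-nonzero _ h′
  ... | j , h″ with X i j in p
  ... | true = (i , j) , p

  ∋⇒size≥1 : (X : DiagSet n) (e : Chord n) → X ∋ e → 1 ≤ size X
  ∋⇒size≥1 X e h rewrite size-remove X e h = s≤s z≤n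

  size-≤⇒⊇ : (W X : DiagSet n) → W ⊆ X → size X ≤ size W → X ⊆ W
  size-≤⇒⊇ W X W⊆X le i j h with (i , j) ∈? W
  ... | yes w = w
  ... | no ¬w = ⊥-elim (<⇒≱ W<X le)
    where
    W<X : size W < size X
    W<X rewrite size-remove X (i , j) h =
      s≤s (size-mono W (X ─ (i , j)) λ a b wa → ─-intro X (i , j) (a , b) (W⊆X a b wa) λ p → ¬w (∋-subst {X = W} p wa))

  size≤1⇒unique : (X : DiagSet n) → size X ≤ 1 → (e e′ : Chord n) → X ∋ e → X ∋ e′ → e ≡ e′
  size≤1⇒unique X le e e′ h h′ with e ≟ᶜ e′
  ... | yes p = p
  ... | no ¬p = ⊥-elim (<⇒≱ 1<X le)
    where
    1<X : 1 < size X
    1<X rewrite size-remove X e h = s≤s (∋⇒size≥1 (X ─ e) e′ (─-intro X e e′ h′ (¬p ∘ sym)))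

  size-gap : (P Q : DiagSet n) → size (P ∩ Q) < size P → ∃ λ x → (P ∋ x) × ¬ (Q ∋ x)
  size-gap P Q lt = go (size (P ∖ Q)) refl
    where
    go : (k : ℕ) → size (P ∖ Q) ≡ k → ∃ λ x → (P ∋ x) × ¬ (Q ∋ x)
    go zero e = ⊥-elim (<-irrefl (sym (trans (size-split P Q) (trans (cong (size (P ∩ Q) +_) e) (+-identityʳ _)))) lt)
    go (suc _) e with nonempty (P ∖ Q) (subst (1 ≤_) (sym e) (s≤s z≤n))
    ... | x , h = x , ∖-elimˡ P Q (proj₁ x) (proj₂ x) h , ∖-elimʳ P Q (proj₁ x) (proj₂ x) h

  ⊆-or-witness : (X Y : DiagSet n) → X ⊆ Y ⊎ (∃ λ x → (X ∋ x) × ¬ (Y ∋ x))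
  ⊆-or-witness X Y = go (size (X ∖ Y)) refl
    where
    go : (k : ℕ) → size (X ∖ Y) ≡ k → X ⊆ Y ⊎ (∃ λ x → (X ∋ x) × ¬ (Y ∋ x))
    go zero e = inj₁ λ i j h → case (i , j) ∈? Y of λ where
      (yes Yx) → Yx
      (no ¬Yx) → ⊥-elim (<⇒≱ (subst (1 ≤_) e (∋⇒size≥1 (X ∖ Y) (i , j) (∖-intro X Y (i , j) h ¬Yx))) ≤-refl)
    go (suc _) e with nonempty (X ∖ Y) (subst (1 ≤_) (sym e) (s≤s z≤n))
    ... | x , h = inj₂ (x , ∖-elimˡ X Y (proj₁ x) (proj₂ x) h , ∖-elimʳ X Y (proj₁ x) (proj₂ x) h)

-- A noncrossing set has at most n - 3 diagonals

maxᶠ : {m : ℕ} → (Fin m → ℕ) → ℕ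
maxᶠ {zero} f = 0
maxᶠ {suc m} f = f fz ⊔ maxᶠ (λ r → f (fs r))

maxᶠ-≥ : {m : ℕ} (f : Fin m → ℕ) (r : Fin m) → f r ≤ maxᶠ f
maxᶠ-≥ {suc m} f fz = m≤m⊔n _ _
maxᶠ-≥ {suc m} f (fs r) = ≤-trans (maxᶠ-≥ (λ r → f (fs r)) r) (m≤n⊔m (f fz) _)

maxᶠ-attained : {m : ℕ} (f : Fin m → ℕ) → (maxᶠ f ≡ 0) ⊎ (∃ λ r → maxᶠ f ≡ f r)
maxᶠ-attained {zero} f = inj₁ refl
maxᶠ-attained {suc m} f with ≤-total (maxᶠ (λ r → f (fs r))) (f fz)
... | inj₁ le = inj₂ (fz , m≥n⇒m⊔n≡m le)
... | inj₂ ge with maxᶠ-attained (λ r → f (fs r))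
... | inj₁ z = inj₁ (trans (m≤n⇒m⊔n≡n ge) z)
... | inj₂ (r , q) = inj₂ (fs r , trans (m≤n⇒m⊔n≡n ge) q)

countBelow : ℕ → (ℕ → Bool) → ℕ
countBelow zero P = 0
countBelow (suc N) P = χ (P N) + countBelow N P

_─ℕ_ : (ℕ → Bool) → ℕ → (ℕ → Bool)
(P ─ℕ q) x = P x ∧ not (does (x ≟ q))

countBelow-cong : (N : ℕ) (P Q : ℕ → Bool) → (∀ x → x < N → P x ≡ Q x) → countBelow N P ≡ countBelow N Q
countBelow-cong zero P Q e = refl
countBelow-cong (suc N) P Q e = cong₂ _+_ (cong χ (e N ≤-refl)) (countBelow-cong N P Q (λ x lt → e x (m<n⇒m<1+n lt)))

countBelow-remove : (N : ℕ) (P : ℕ → Bool) (q : ℕ) → q < N → P q ≡ true → countBelow N P ≡ suc (countBelow N (P ─ℕ q))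
countBelow-remove (suc N) P q q<1+N Pq with N ≟ q
... | yes refl rewrite Pq | dec-true (N ≟ N) refl = cong suc (countBelow-cong N P (P ─ℕ N) unchanged)
  where
  unchanged : ∀ x → x < N → P x ≡ (P ─ℕ N) x
  unchanged x x<N rewrite dec-false (x ≟ N) (<⇒≢ x<N) = sym (BP.∧-identityʳ (P x))
... | no N≢q rewrite dec-false (N ≟ q) N≢q with P N
...   | true = cong suc (countBelow-remove N P q (≤∧≢⇒< (≤-pred q<1+N) (N≢q ∘ sym)) Pq)
...   | false = countBelow-remove N P q (≤∧≢⇒< (≤-pred q<1+N) (N≢q ∘ sym)) Pq

countBelow-all : (N : ℕ) → countBelow N (λ _ → true) ≡ N
countBelow-all zero = refl
countBelow-all (suc N) = cong suc (countBelow-all N)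

module _ {n : ℕ} where
  size≤countBelow : (N : ℕ) (P : ℕ → Bool) (f : Chord n → ℕ) (X : DiagSet n) →
    (∀ e → X ∋ e → f e < N × P (f e) ≡ true) →
    (∀ e e′ → X ∋ e → X ∋ e′ → e ≢ e′ → f e ≢ f e′) →
    size X ≤ countBelow N P
  size≤countBelow N P f X into inj = go (size X) X P refl (λ _ _ h → h) into
    where
    go : (k : ℕ) (Y : DiagSet n) (Q : ℕ → Bool) → size Y ≡ k → Y ⊆ X →
         (∀ e → Y ∋ e → f e < N × Q (f e) ≡ true) → size Y ≤ countBelow N Q
    go zero Y Q Y≡ _ _ rewrite Y≡ = z≤n
    go (suc k) Y Q Y≡ Y⊆X intoQ with nonempty Y (subst (1 ≤_) (sym Y≡) (s≤s z≤n))
    ... | e , Ye = begin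
        size Y                             ≡⟨ size-remove Y e Ye ⟩
        suc (size (Y ─ e))                 ≤⟨ s≤s (go k (Y ─ e) (Q ─ℕ f e) Y─e≡ (λ i j h → Y⊆X i j (─-elim Y e i j h)) intoQ─) ⟩
        suc (countBelow N (Q ─ℕ f e))      ≡⟨ sym (countBelow-remove N Q (f e) (proj₁ (intoQ e Ye)) (proj₂ (intoQ e Ye))) ⟩
        countBelow N Q                     ∎
      where
      open ≤-Reasoning
      Y─e≡ : size (Y ─ e) ≡ k
      Y─e≡ = suc-injective (trans (sym (size-remove Y e Ye)) Y≡)
      intoQ─ : ∀ e′ → (Y ─ e) ∋ e′ → f e′ < N × (Q ─ℕ f e) (f e′) ≡ true
      intoQ─ e′ h with intoQ e′ (─-elim Y e _ _ h)
      ... | lt , Qe′ rewrite Qe′ = lt , cong not (dec-false (f e′ ≟ f e)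
              (inj e′ e (Y⊆X _ _ (─-elim Y e _ _ h)) (Y⊆X _ _ Ye) (─-elim≢ Y e _ _ h)))

-- For a chord (i , j) of a noncrossing set X, apex i j is the last vertex before j joined
-- to i by a chord of X (or i + 1).  The apexes of distinct chords of X are distinct,
-- lie strictly inside the polygon and avoid the apex of the outer side (0 , n - 1).
module Apexes {n : ℕ} (X : DiagSet n)
  (diag : ∀ i j → X i j ≡ true → IsDiagonal n i j)
  (noncross : ∀ i j k l → X i j ≡ true → X k l ≡ true → ¬ Cross i j k l) where

  joinedBelow : Fin n → ℕ → Fin n → ℕ
  joinedBelow i j r with X i r | toℕ r <? j
  ... | true | yes _ = toℕ r
  ... | _ | _ = 0

  apex : Fin n → ℕ → ℕ
  apex i j = suc (toℕ i) ⊔ maxᶠ (joinedBelow i j)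

  apex> : ∀ i j → toℕ i < apex i j
  apex> i j = m≤m⊔n (suc (toℕ i)) (maxᶠ (joinedBelow i j))

  apex< : ∀ i j → suc (toℕ i) < j → apex i j < j
  apex< i j i+1<j = ⊔-lub i+1<j max<
    where
    joined< : ∀ r → joinedBelow i j r < j
    joined< r with X i r | toℕ r <? j
    ... | true | yes r<j = r<j
    ... | true | no _ = <-trans (s≤s z≤n) i+1<j
    ... | false | _ = <-trans (s≤s z≤n) i+1<j
    max< : maxᶠ (joinedBelow i j) < j
    max< with maxᶠ-attained (joinedBelow i j)
    ... | inj₁ z rewrite z = <-trans (s≤s z≤n) i+1<j
    ... | inj₂ (r , q) rewrite q = joined< r

  apex-cases : ∀ i j → (apex i j ≡ suc (toℕ i)) ⊎ (∃ λ r → (X i r ≡ true) × (apex i j ≡ toℕ r))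
  apex-cases i j with ≤-total (maxᶠ (joinedBelow i j)) (suc (toℕ i))
  ... | inj₁ le = inj₁ (m≥n⇒m⊔n≡m le)
  ... | inj₂ ge with maxᶠ-attained (joinedBelow i j)
  ...   | inj₁ z = inj₁ (trans (m≤n⇒m⊔n≡n ge) (≤-antisym (subst (_≤ _) (sym z) z≤n) ge))
  ...   | inj₂ (r , q) with X i r in p | toℕ r <? j
  ...     | true | yes _ = inj₂ (r , p , trans (m≤n⇒m⊔n≡n ge) q)
  ...     | true | no _ = inj₁ (trans (m≤n⇒m⊔n≡n ge) (≤-antisym (subst (_≤ _) (sym q) z≤n) ge))
  ...     | false | _ = inj₁ (trans (m≤n⇒m⊔n≡n ge) (≤-antisym (subst (_≤ _) (sym q) z≤n) ge))

  apex-≥ : ∀ i j r → X i r ≡ true → toℕ r < j → toℕ r ≤ apex i j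
  apex-≥ i j r Xir r<j = ≤-trans r≤joined (≤-trans (maxᶠ-≥ (joinedBelow i j) r) (m≤n⊔m _ _))
    where
    r≤joined : toℕ r ≤ joinedBelow i j r
    r≤joined rewrite Xir with toℕ r <? j
    ... | yes _ = ≤-refl
    ... | no r≮j = ⊥-elim (r≮j r<j)

  no-chord-over-apex : (i : Fin n) (j : ℕ) (a b : Fin n) → X a b ≡ true → toℕ i ≤ toℕ a → toℕ b ≤ j →
    (toℕ a ≡ toℕ i → toℕ b ≢ j) → toℕ a < apex i j → apex i j < toℕ b → ⊥
  no-chord-over-apex i j a b Xab i≤a b≤j ≢ij a<p p<b with m≤n⇒m<n∨m≡n i≤a
  ... | inj₂ i≡a with FP.toℕ-injective i≡a
  ...   | refl = <⇒≱ p<b (apex-≥ i j b Xab (≤∧≢⇒< b≤j (≢ij refl)))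
  no-chord-over-apex i j a b Xab i≤a b≤j ≢ij a<p p<b | inj₁ i<a with apex-cases i j
  ... | inj₁ e = <⇒≱ i<a (≤-pred (subst (toℕ a <_) e a<p))
  ... | inj₂ (r , Xir , e) = noncross i r a b Xir Xab (inj₁ (i<a , subst (toℕ a <_) e a<p , subst (_< toℕ b) e p<b))

  apexOf : Chord n → ℕ
  apexOf (i , j) = apex i (toℕ j)

  apexOf-inside : ∀ i j → X i j ≡ true → (toℕ i < apexOf (i , j)) × (apexOf (i , j) < toℕ j)
  apexOf-inside i j Xij = apex> i (toℕ j) , apex< i (toℕ j) (subst (_≤ toℕ j) (+-comm (toℕ i) 2) (proj₁ (diag i j Xij)))

  private
    distinct : ∀ {i j a b : Fin n} → (i , j) ≢ (a , b) → toℕ a ≡ toℕ i → toℕ b ≢ toℕ j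
    distinct ≢ e₁ e₂ with FP.toℕ-injective e₁ | FP.toℕ-injective e₂
    ... | refl | refl = ≢ refl

  apexOf-injective : ∀ e e′ → X ∋ e → X ∋ e′ → e ≢ e′ → apexOf e ≢ apexOf e′
  apexOf-injective (i , j) (a , b) Xij Xab ≢ eq
    with apexOf-inside i j Xij | apexOf-inside a b Xab
       | toℕ i ≤? toℕ a | toℕ b ≤? toℕ j | toℕ a ≤? toℕ i | toℕ j ≤? toℕ b
  ... | _ | a<p , p<b | yes i≤a | yes b≤j | _ | _ =
    no-chord-over-apex i (toℕ j) a b Xab i≤a b≤j (distinct ≢) (subst (toℕ a <_) (sym eq) a<p) (subst (_< toℕ b) (sym eq) p<b)
  ... | i<p , p<j | _ | _ | _ | yes a≤i | yes j≤b =
    no-chord-over-apex a (toℕ b) i j Xij a≤i j≤b (distinct (≢ ∘ sym)) (subst (toℕ i <_) eq i<p) (subst (_< toℕ j) eq p<j)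
  ... | _ | _ | no i≰a | _ | no a≰i | _ = ⊥-elim (a≰i (<⇒≤ (≰⇒> i≰a)))
  ... | i<p , _ | _ , p<b | no i≰a | _ | yes _ | no j≰b =
    noncross a b i j Xab Xij (inj₁ (≰⇒> i≰a , <-trans i<p (subst (_< toℕ b) (sym eq) p<b) , ≰⇒> j≰b))
  ... | _ , p<j | a<p , _ | yes _ | no b≰j | no a≰i | _ =
    noncross i j a b Xij Xab (inj₁ (≰⇒> a≰i , <-trans a<p (subst (_< toℕ j) eq p<j) , ≰⇒> b≰j))
  ... | _ | _ | yes _ | no b≰j | yes _ | no j≰b = ⊥-elim (<-asym (≰⇒> b≰j) (≰⇒> j≰b))

  module Outer (3≤n : 3 ≤ n) where
    N : ℕ
    N = n ∸ 1

    1+N≡n : suc N ≡ n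
    1+N≡n = m+[n∸m]≡n {1} {n} (≤-trans (s≤s z≤n) 3≤n)

    v₀ : Fin n
    v₀ = fromℕ< (≤-trans (s≤s z≤n) 3≤n)

    p₀ : ℕ
    p₀ = apex v₀ N

    ≤N : (b : Fin n) → toℕ b ≤ N
    ≤N b = ≤-pred (subst (toℕ b <_) (sym 1+N≡n) (FP.toℕ<n b))

    apexOf≢p₀ : ∀ i j → X i j ≡ true → apexOf (i , j) ≢ p₀
    apexOf≢p₀ i j Xij e = no-chord-over-apex v₀ N i j Xij (subst (_≤ toℕ i) (sym (FP.toℕ-fromℕ< _)) z≤n) (≤N j) not-side
      (subst (toℕ i <_) e (proj₁ (apexOf-inside i j Xij))) (subst (_< toℕ j) e (proj₂ (apexOf-inside i j Xij)))
      where
      not-side : toℕ i ≡ toℕ v₀ → toℕ j ≢ N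
      not-side e₁ e₂ = proj₂ (diag i j Xij) (trans e₁ (FP.toℕ-fromℕ< _) , trans (cong suc e₂) 1+N≡n)

    p₀<N : p₀ < N
    p₀<N = apex< v₀ N (subst (λ v → suc v < N) (sym (FP.toℕ-fromℕ< _)) (≤-pred (subst (3 ≤_) (sym 1+N≡n) 3≤n)))

    p₀≢0 : p₀ ≢ 0
    p₀≢0 e = <⇒≱ (apex> v₀ N) (subst (_≤ toℕ v₀) (sym e) z≤n)

    Inner : ℕ → Bool
    Inner = ((λ _ → true) ─ℕ 0) ─ℕ p₀

    countBelow-Inner : countBelow N Inner ≡ n ∸ 3
    countBelow-Inner = begin
      countBelow N Inner                           ≡⟨ cong (_∸ 2) (sym (trans e₁ (cong suc e₂))) ⟩
      countBelow N (λ _ → true) ∸ 2               ≡⟨ cong (_∸ 2) (countBelow-all N) ⟩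
      N ∸ 2                                        ≡⟨ ∸-+-assoc n 1 2 ⟩
      n ∸ 3                                        ∎
      where
      open ≡-Reasoning
      e₁ : countBelow N (λ _ → true) ≡ suc (countBelow N ((λ _ → true) ─ℕ 0))
      e₁ = countBelow-remove N (λ _ → true) 0 (≤-trans (s≤s z≤n) p₀<N) refl
      e₂ : countBelow N ((λ _ → true) ─ℕ 0) ≡ suc (countBelow N Inner)
      e₂ = countBelow-remove N ((λ _ → true) ─ℕ 0) p₀ p₀<N (cong not (dec-false (p₀ ≟ 0) p₀≢0))

    size≤n∸3 : size X ≤ n ∸ 3
    size≤n∸3 = subst (size X ≤_) countBelow-Inner (size≤countBelow N Inner apexOf X into apexOf-injective)
      where
      into : ∀ e → X ∋ e → apexOf e < N × Inner (apexOf e) ≡ true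
      into (i , j) Xij with apexOf-inside i j Xij
      ... | i<p , p<j rewrite dec-false (apexOf (i , j) ≟ 0) (<⇒≢ (≤-<-trans z≤n i<p) ∘ sym)
                            | dec-false (apexOf (i , j) ≟ p₀) (apexOf≢p₀ i j Xij) = <-≤-trans p<j (≤N j) , refl

noncrossing-size≤ : {n : ℕ} (X : DiagSet n) →
  (∀ i j → X i j ≡ true → IsDiagonal n i j) →
  (∀ i j k l → X i j ≡ true → X k l ≡ true → ¬ Cross i j k l) → size X ≤ n ∸ 3
noncrossing-size≤ {n} X diag noncross with 3 ≤? n
... | yes 3≤n = Apexes.Outer.size≤n∸3 X diag noncross 3≤n
... | no 3≰n with size X in e
...   | zero = z≤n
...   | suc k with nonempty X (subst (1 ≤_) (sym e) (s≤s z≤n))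
...     | (i , j) , Xij = ⊥-elim (3≰n (≤-trans (s≤s (≤-trans (m≤n+m 2 (toℕ i)) (proj₁ (diag i j Xij)))) (FP.toℕ<n j)))

-- Crossing patterns decided through ranks

Crossℕ : ℕ → ℕ → ℕ → ℕ → Set
Crossℕ i j k l = ((i < k) × (k < j) × (j < l)) ⊎ ((k < i) × (i < l) × (l < j))

crossℕ? : ∀ i j k l → Dec (Crossℕ i j k l)
crossℕ? i j k l = (i <? k ×-dec k <? j ×-dec j <? l) ⊎-dec (k <? i ×-dec i <? l ×-dec l <? j)

odd : ℕ → Bool
odd zero = false
odd (suc zero) = true
odd (suc (suc n)) = odd n

-- rank vs x locates x among the anchors vs: 2 k + 1 if x is the k-th anchor, 2 k if x lies
-- strictly between anchors k - 1 and k.  Chords whose endpoints are anchors cross another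
-- chord exactly when their ranks do, so crossing patterns relative to a fixed polygon of
-- anchors reduce to finitely many cases, which are decided below by evaluation.
opaque
  rank : List ℕ → ℕ → ℕ
  rank [] x = 0
  rank (v ∷ vs) x with <-cmp x v
  ... | tri< _ _ _ = 0
  ... | tri≈ _ _ _ = 1
  ... | tri> _ _ _ = 2 + rank vs x

  rank-[] : ∀ x → rank [] x ≡ 0
  rank-[] x = refl

  rank-< : ∀ v vs x → x < v → rank (v ∷ vs) x ≡ 0
  rank-< v vs x x<v with <-cmp x v
  ... | tri< _ _ _ = refl
  ... | tri≈ x≮v _ _ = ⊥-elim (x≮v x<v)
  ... | tri> x≮v _ _ = ⊥-elim (x≮v x<v)

  rank-≡ : ∀ v vs → rank (v ∷ vs) v ≡ 1
  rank-≡ v vs with <-cmp v v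
  ... | tri< _ v≢v _ = ⊥-elim (v≢v refl)
  ... | tri≈ _ _ _ = refl
  ... | tri> _ v≢v _ = ⊥-elim (v≢v refl)

  rank-> : ∀ v vs x → v < x → rank (v ∷ vs) x ≡ 2 + rank vs x
  rank-> v vs x v<x with <-cmp x v
  ... | tri< _ _ x≯v = ⊥-elim (x≯v v<x)
  ... | tri≈ _ _ x≯v = ⊥-elim (x≯v v<x)
  ... | tri> _ _ _ = refl

rank-<-anchorʳ : ∀ vs x y → odd (rank vs y) ≡ true → (x < y → rank vs x < rank vs y) × (rank vs x < rank vs y → x < y)
rank-<-anchorʳ [] x y oy rewrite rank-[] y = case oy of λ ()
rank-<-anchorʳ (v ∷ vs) x y oy with <-cmp y v
... | tri< yv _ _ rewrite rank-< v vs y yv = case oy of λ ()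
... | tri≈ _ refl _ rewrite rank-≡ y vs with <-cmp x y
...   | tri< xy _ _ rewrite rank-< y vs x xy = (λ _ → s≤s z≤n) , (λ _ → xy)
...   | tri≈ _ refl _ rewrite rank-≡ x vs = (λ l → ⊥-elim (<-irrefl refl l)) , (λ l → ⊥-elim (<-irrefl refl l))
...   | tri> _ _ yx rewrite rank-> y vs x yx = (λ l → ⊥-elim (<-asym l yx)) , (λ { (s≤s ()) })
rank-<-anchorʳ (v ∷ vs) x y oy | tri> _ _ vy rewrite rank-> v vs y vy with <-cmp x v
... | tri< xv _ _ rewrite rank-< v vs x xv = (λ _ → s≤s z≤n) , (λ _ → <-trans xv vy)
... | tri≈ _ refl _ rewrite rank-≡ x vs = (λ _ → s≤s (s≤s z≤n)) , (λ _ → vy)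
... | tri> _ _ vx rewrite rank-> v vs x vx with rank-<-anchorʳ vs x y oy
... | a , b = (λ l → s≤s (s≤s (a l))) , (λ l → b (≤-pred (≤-pred l)))

rank-<-anchorˡ : ∀ vs x y → odd (rank vs x) ≡ true → (x < y → rank vs x < rank vs y) × (rank vs x < rank vs y → x < y)
rank-<-anchorˡ [] x y ox rewrite rank-[] x = case ox of λ ()
rank-<-anchorˡ (v ∷ vs) x y ox with <-cmp x v
... | tri< xv _ _ rewrite rank-< v vs x xv = case ox of λ ()
... | tri≈ _ refl _ rewrite rank-≡ x vs with <-cmp y x
...   | tri< yx _ _ rewrite rank-< x vs y yx = (λ l → ⊥-elim (<-asym l yx)) , (λ ())
...   | tri≈ _ refl _ rewrite rank-≡ y vs = (λ l → ⊥-elim (<-irrefl refl l)) , (λ l → ⊥-elim (<-irrefl refl l))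
...   | tri> _ _ xy rewrite rank-> x vs y xy = (λ _ → s≤s (s≤s z≤n)) , (λ _ → xy)
rank-<-anchorˡ (v ∷ vs) x y ox | tri> _ _ vx rewrite rank-> v vs x vx with <-cmp y v
... | tri< yv _ _ rewrite rank-< v vs y yv = (λ l → ⊥-elim (<-asym (<-trans yv vx) l)) , (λ { () })
... | tri≈ _ refl _ rewrite rank-≡ y vs = (λ l → ⊥-elim (<-asym vx l)) , (λ { (s≤s ()) })
... | tri> _ _ vy rewrite rank-> v vs y vy with rank-<-anchorˡ vs x y ox
... | a , b = (λ l → s≤s (s≤s (a l))) , (λ l → b (≤-pred (≤-pred l)))

rank-injective : ∀ vs x y → odd (rank vs y) ≡ true → rank vs x ≡ rank vs y → x ≡ y
rank-injective vs x y oy e with <-cmp x y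
... | tri< l _ _ = ⊥-elim (<-irrefl e (proj₁ (rank-<-anchorʳ vs x y oy) l))
... | tri≈ _ q _ = q
... | tri> _ _ g = ⊥-elim (<-irrefl (sym e) (proj₁ (rank-<-anchorˡ vs y x oy) g))

rank-mono : ∀ vs x y → x ≤ y → rank vs x ≤ rank vs y
rank-mono [] x y le rewrite rank-[] x = z≤n
rank-mono (v ∷ vs) x y le with <-cmp x v
... | tri< xv _ _ rewrite rank-< v vs x xv = z≤n
... | tri≈ _ refl _ rewrite rank-≡ x vs with <-cmp y x
...   | tri< yx _ _ = ⊥-elim (<⇒≱ yx le)
...   | tri≈ _ refl _ rewrite rank-≡ y vs = ≤-refl
...   | tri> _ _ xy rewrite rank-> x vs y xy = s≤s z≤n
rank-mono (v ∷ vs) x y le | tri> _ _ vx rewrite rank-> v vs x vx | rank-> v vs y (<-≤-trans vx le) = s≤s (s≤s (rank-mono vs x y le))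

rank-bounded : ∀ vs x → rank vs x ≤ 2 * length vs
rank-bounded [] x rewrite rank-[] x = z≤n
rank-bounded (v ∷ vs) x with <-cmp x v
... | tri< xv _ _ rewrite rank-< v vs x xv = z≤n
... | tri≈ _ refl _ rewrite rank-≡ x vs = s≤s z≤n
... | tri> _ _ vx rewrite rank-> v vs x vx = subst (2 + rank vs x ≤_) (sym (*-distribˡ-+ 2 1 (length vs))) (s≤s (s≤s (rank-bounded vs x)))

rank-after : ∀ {v x ρ} vs → v < x → rank vs x ≡ ρ → rank (v ∷ vs) x ≡ 2 + ρ
rank-after vs v<x p = trans (rank-> _ vs _ v<x) (cong (2 +_) p)

module Ranks (vs : List ℕ) where
  Anchor : ℕ → ℕ → Set
  Anchor k ρ = (rank vs k ≡ ρ) × (odd ρ ≡ true)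

  <-anchor : ∀ {x y ρ} → Anchor y ρ → x < y → rank vs x < ρ
  <-anchor (refl , o) = proj₁ (rank-<-anchorʳ vs _ _ o)

  <-anchor⁻¹ : ∀ {x y ρ} → Anchor y ρ → rank vs x < ρ → x < y
  <-anchor⁻¹ (refl , o) = proj₂ (rank-<-anchorʳ vs _ _ o)

  anchor-< : ∀ {x y ρ} → Anchor x ρ → x < y → ρ < rank vs y
  anchor-< (refl , o) = proj₁ (rank-<-anchorˡ vs _ _ o)

  anchor-<⁻¹ : ∀ {x y ρ} → Anchor x ρ → ρ < rank vs y → x < y
  anchor-<⁻¹ (refl , o) = proj₂ (rank-<-anchorˡ vs _ _ o)

  anchor-injective : ∀ {x k ρ} → Anchor k ρ → rank vs x ≡ ρ → x ≡ k
  anchor-injective (refl , o) = rank-injective vs _ _ o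

  cross↑ : ∀ {x y k l ρ σ} → Anchor k ρ → Anchor l σ → Crossℕ x y k l → Crossℕ (rank vs x) (rank vs y) ρ σ
  cross↑ K L (inj₁ (x<k , k<y , y<l)) = inj₁ (<-anchor K x<k , anchor-< K k<y , <-anchor L y<l)
  cross↑ K L (inj₂ (k<x , x<l , l<y)) = inj₂ (anchor-< K k<x , <-anchor L x<l , anchor-< L l<y)

  cross↓ : ∀ {x y k l ρ σ} → Anchor k ρ → Anchor l σ → Crossℕ (rank vs x) (rank vs y) ρ σ → Crossℕ x y k l
  cross↓ K L (inj₁ (x<k , k<y , y<l)) = inj₁ (<-anchor⁻¹ K x<k , anchor-<⁻¹ K k<y , <-anchor⁻¹ L y<l)
  cross↓ K L (inj₂ (k<x , x<l , l<y)) = inj₂ (anchor-<⁻¹ K k<x , <-anchor⁻¹ L x<l , anchor-<⁻¹ L l<y)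

  ¬cross↑ : ∀ {x y k l ρ σ} → Anchor k ρ → Anchor l σ → ¬ Crossℕ x y k l → ¬ Crossℕ (rank vs x) (rank vs y) ρ σ
  ¬cross↑ K L ¬c = ¬c ∘ cross↓ K L

  ¬cross↓ : ∀ {x y k l ρ σ} → Anchor k ρ → Anchor l σ → ¬ Crossℕ (rank vs x) (rank vs y) ρ σ → ¬ Crossℕ x y k l
  ¬cross↓ K L ¬c = ¬c ∘ cross↑ K L

-- A property of the ranks p ≤ q ≤ B of the endpoints of a chord.
Upto : ℕ → (ℕ → ℕ → Set) → Set
Upto B P = ∀ {q} → q < suc B → ∀ {p} → p < suc q → P p q

upto? : ∀ B {P : ℕ → ℕ → Set} → (∀ p q → Dec (P p q)) → Dec (Upto B P)
upto? B P? = allUpTo? (λ q → allUpTo? (λ p → P? p q) (suc q)) (suc B)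

at-chord : ∀ vs {P : ℕ → ℕ → Set} {x y} → x ≤ y → Upto (2 * length vs) P → P (rank vs x) (rank vs y)
at-chord vs {y = y} x≤y h = h (s≤s (rank-bounded vs y)) (s≤s (rank-mono vs _ y x≤y))

-- Quadrilateral a < b < c < e with anchors at ranks 1, 3, 5, 7.
quadrilateral-sides : Upto 8 λ p q → ¬ Crossℕ p q 1 5 → ¬ Crossℕ p q 3 7 →
  ¬ Crossℕ p q 1 3 × ¬ Crossℕ p q 3 5 × ¬ Crossℕ p q 5 7 × ¬ Crossℕ p q 1 7
quadrilateral-sides = from-yes (upto? 8 λ p q → ¬? (crossℕ? p q 1 5) →-dec ¬? (crossℕ? p q 3 7) →-dec
  ¬? (crossℕ? p q 1 3) ×-dec ¬? (crossℕ? p q 3 5) ×-dec ¬? (crossℕ? p q 5 7) ×-dec ¬? (crossℕ? p q 1 7))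

quadrilateral-flip : Upto 8 λ p q → ¬ Crossℕ p q 1 3 → ¬ Crossℕ p q 3 5 → ¬ Crossℕ p q 5 7 → ¬ Crossℕ p q 1 7 →
  (Crossℕ p q 1 5 → p ≡ 3 × q ≡ 7) × (Crossℕ p q 3 7 → p ≡ 1 × q ≡ 5)
quadrilateral-flip = from-yes (upto? 8 λ p q → ¬? (crossℕ? p q 1 3) →-dec ¬? (crossℕ? p q 3 5) →-dec
  ¬? (crossℕ? p q 5 7) →-dec ¬? (crossℕ? p q 1 7) →-dec
  (crossℕ? p q 1 5 →-dec p ≟ 3 ×-dec q ≟ 7) ×-dec (crossℕ? p q 3 7 →-dec p ≟ 1 ×-dec q ≟ 5))

-- Triangle a < p < b with anchors at ranks 1, 3, 5.
triangle-inner : Upto 6 λ p q → ¬ Crossℕ p q 1 5 → ¬ Crossℕ p q 1 3 → Crossℕ p q 3 5 → p ≡ 1 × q ≡ 4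
triangle-inner = from-yes (upto? 6 λ p q → ¬? (crossℕ? p q 1 5) →-dec ¬? (crossℕ? p q 1 3) →-dec
  crossℕ? p q 3 5 →-dec p ≟ 1 ×-dec q ≟ 4)

triangle-outer : Upto 6 λ p q → ¬ Crossℕ p q 3 5 → ¬ Crossℕ p q 1 3 → Crossℕ p q 1 5 →
  (p ≡ 3 × q ≡ 6) ⊎ (p ≡ 0 × q ≡ 3)
triangle-outer = from-yes (upto? 6 λ p q → ¬? (crossℕ? p q 3 5) →-dec ¬? (crossℕ? p q 1 3) →-dec
  crossℕ? p q 1 5 →-dec ((p ≟ 3 ×-dec q ≟ 6) ⊎-dec (p ≟ 0 ×-dec q ≟ 3)))

∸-suc : ∀ n k → suc k ≤ n → n ∸ k ≡ suc (n ∸ suc k)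
∸-suc (suc n) zero _ = refl
∸-suc (suc n) (suc k) (s≤s k<n) = ∸-suc n k k<n

module _ {n : ℕ} where
  Tri : DiagSet n → Set
  Tri = IsTriangulation n

  Diagonal : Chord n → Set
  Diagonal (i , j) = IsDiagonal n i j

  Crosses : Chord n → Chord n → Set
  Crosses (i , j) (k , l) = Cross i j k l

  crosses? : ∀ e f → Dec (Crosses e f)
  crosses? (i , j) (k , l) = crossℕ? (toℕ i) (toℕ j) (toℕ k) (toℕ l)

  tri-diagonal : {X : DiagSet n} → Tri X → ∀ e → X ∋ e → Diagonal e
  tri-diagonal t (i , j) h = proj₁ t i j h

  tri-noncrossing : {X : DiagSet n} → Tri X → ∀ e f → X ∋ e → X ∋ f → ¬ Crosses e f
  tri-noncrossing t (i , j) (k , l) he hf = proj₁ (proj₂ t) i j k l he hf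

  tri-size : {X : DiagSet n} → Tri X → size X ≡ n ∸ 3
  tri-size {X} t = trans (sym (card≡size X)) (proj₂ (proj₂ t))

  mkTri : (X : DiagSet n) → (∀ e → X ∋ e → Diagonal e) → (∀ e f → X ∋ e → X ∋ f → ¬ Crosses e f) → size X ≡ n ∸ 3 → Tri X
  mkTri X d nc c = (λ i j h → d (i , j) h) , (λ i j k l h₁ h₂ → nc (i , j) (k , l) h₁ h₂) , trans (card≡size X) c

  crosses-sym : ∀ e f → Crosses e f → Crosses f e
  crosses-sym e f (inj₁ c) = inj₂ c
  crosses-sym e f (inj₂ c) = inj₁ c

  crosses-irrefl : ∀ e → ¬ Crosses e e
  crosses-irrefl e (inj₁ (i<i , _)) = <-irrefl refl i<i
  crosses-irrefl e (inj₂ (i<i , _)) = <-irrefl refl i<i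

  diagonal-< : ∀ e → Diagonal e → toℕ (proj₁ e) < toℕ (proj₂ e)
  diagonal-< (i , j) d = <-≤-trans (m<m+n (toℕ i) {2} (s≤s z≤n)) (proj₁ d)

  diagonal-≤ : ∀ e → Diagonal e → toℕ (proj₁ e) ≤ toℕ (proj₂ e)
  diagonal-≤ e d = <⇒≤ (diagonal-< e d)

  Side : Chord n → Set
  Side (i , j) = (toℕ j ≡ suc (toℕ i)) ⊎ ((toℕ i ≡ 0) × (suc (toℕ j) ≡ n))

  side-uncrossed : ∀ s t → Side s → ¬ Crosses t s
  side-uncrossed (i , j) (k , l) (inj₁ e) (inj₁ (_ , i<l , l<j)) = <⇒≱ (subst (toℕ l <_) e l<j) i<l
  side-uncrossed (i , j) (k , l) (inj₁ e) (inj₂ (i<k , k<j , _)) = <⇒≱ (subst (toℕ k <_) e k<j) i<k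
  side-uncrossed (i , j) (k , l) (inj₂ (i≡0 , _)) (inj₁ (k<i , _)) = <⇒≱ k<i (subst (_≤ toℕ k) (sym i≡0) z≤n)
  side-uncrossed (i , j) (k , l) (inj₂ (_ , 1+j≡n)) (inj₂ (_ , _ , j<l)) = <⇒≱ (FP.toℕ<n l) (subst (_≤ toℕ l) 1+j≡n j<l)

  InOrSide : DiagSet n → Chord n → Set
  InOrSide X s = (X ∋ s) ⊎ Side s

  inOrSide-uncrossed : {X : DiagSet n} → Tri X → ∀ s t → InOrSide X s → X ∋ t → ¬ Crosses t s
  inOrSide-uncrossed tX s t (inj₁ Xs) Xt = tri-noncrossing tX t s Xt Xs
  inOrSide-uncrossed tX s t (inj₂ side) Xt = side-uncrossed s t side

  diagonal-or-side : ∀ e → toℕ (proj₁ e) < toℕ (proj₂ e) → Diagonal e ⊎ Side e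
  diagonal-or-side (i , j) i<j with m≤n⇒m<n∨m≡n i<j
  ... | inj₂ eq = inj₂ (inj₁ (sym eq))
  ... | inj₁ i+1<j with toℕ i ≟ 0 | suc (toℕ j) ≟ n
  ...   | yes i≡0 | yes 1+j≡n = inj₂ (inj₂ (i≡0 , 1+j≡n))
  ...   | no i≢0 | _ = inj₁ (subst (_≤ toℕ j) (+-comm 2 (toℕ i)) i+1<j , i≢0 ∘ proj₁)
  ...   | yes _ | no 1+j≢n = inj₁ (subst (_≤ toℕ j) (+-comm 2 (toℕ i)) i+1<j , 1+j≢n ∘ proj₂)

  insert-noncrossing : (W : DiagSet n) (x : Chord n) →
    (∀ e f → W ∋ e → W ∋ f → ¬ Crosses e f) → (∀ t → W ∋ t → ¬ Crosses x t) →
    ∀ i j k l → (W ⊕ x) i j ≡ true → (W ⊕ x) k l ≡ true → ¬ Cross i j k l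
  insert-noncrossing W x ncW ncx i j k l h₁ h₂ with ⊕-elim W x i j h₁ | ⊕-elim W x k l h₂
  ... | inj₁ refl | inj₁ refl = crosses-irrefl x
  ... | inj₁ refl | inj₂ b = ncx (k , l) b
  ... | inj₂ a | inj₁ refl = ncx (i , j) a ∘ crosses-sym (i , j) x
  ... | inj₂ a | inj₂ b = ncW (i , j) (k , l) a b

  insert-diagonal : (W : DiagSet n) (x : Chord n) → (∀ e → W ∋ e → Diagonal e) → Diagonal x → ∀ e → (W ⊕ x) ∋ e → Diagonal e
  insert-diagonal W x dW dx e h with ⊕-elim W x (proj₁ e) (proj₂ e) h
  ... | inj₁ refl = dx
  ... | inj₂ w = dW e w

  tri-maximal : {T : DiagSet n} → Tri T → ∀ x → Diagonal x → (∀ t → T ∋ t → ¬ Crosses x t) → T ∋ x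
  tri-maximal {T} tT x dx ncx with x ∈? T
  ... | yes Tx = Tx
  ... | no ¬Tx = ⊥-elim (<-irrefl refl (≤-trans bigger (noncrossing-size≤ (T ⊕ x) diag noncross)))
    where
    bigger : suc (n ∸ 3) ≤ size (T ⊕ x)
    bigger rewrite size-insert T x ¬Tx | tri-size tT = ≤-refl
    diag : ∀ i j → (T ⊕ x) i j ≡ true → IsDiagonal n i j
    diag i j = insert-diagonal T x (tri-diagonal tT) dx (i , j)
    noncross = insert-noncrossing T x (tri-noncrossing tT) ncx

  uncrossed⇒InOrSide : {T : DiagSet n} → Tri T → ∀ s → toℕ (proj₁ s) < toℕ (proj₂ s) → (∀ t → T ∋ t → ¬ Crosses s t) → InOrSide T s
  uncrossed⇒InOrSide tT s lt nc with diagonal-or-side s lt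
  ... | inj₁ d = inj₁ (tri-maximal tT s d nc)
  ... | inj₂ side = inj₂ side

  record OneMore (X W : DiagSet n) : Set where
    constructor mkOneMore
    field
      extra : Chord n
      extra∈ : X ∋ extra
      extra∉ : ¬ (W ∋ extra)
      extra-unique : ∀ x → X ∋ x → ¬ (W ∋ x) → x ≡ extra

  opaque
    oneMore : {X W : DiagSet n} → 4 ≤ n → Tri X → W ⊆ X → size W ≡ n ∸ 4 → OneMore X W
    oneMore {X} {W} 4≤n tX W⊆X ∣W∣ = mkOneMore extra extra∈ extra∉ extra-unique
      where
      X∩W≡W : size (X ∩ W) ≡ size W
      X∩W≡W = size-cong (X ∩ W) W (⊆-antisym (X ∩ W) W (∩-elimʳ X W) (λ i j h → ∩-intro X W (i , j) (W⊆X i j h) h))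
      ∣X∖W∣≡1 : size (X ∖ W) ≡ 1
      ∣X∖W∣≡1 = +-cancelˡ-≡ (n ∸ 4) _ _ (begin
        n ∸ 4 + size (X ∖ W)           ≡⟨ cong (_+ size (X ∖ W)) (sym (trans X∩W≡W ∣W∣)) ⟩
        size (X ∩ W) + size (X ∖ W)     ≡⟨ sym (size-split X W) ⟩
        size X                          ≡⟨ tri-size tX ⟩
        n ∸ 3                           ≡⟨ ∸-suc n 3 4≤n ⟩
        suc (n ∸ 4)                     ≡⟨ +-comm 1 (n ∸ 4) ⟩
        n ∸ 4 + 1                       ∎)
        where open ≡-Reasoning
      witness : ∃ λ e → (X ∖ W) ∋ e
      witness = nonempty (X ∖ W) (≤-reflexive (sym ∣X∖W∣≡1))
      extra : Chord n
      extra = proj₁ witness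
      extra∈ : X ∋ extra
      extra∈ = ∖-elimˡ X W (proj₁ extra) (proj₂ extra) (proj₂ witness)
      extra∉ : ¬ (W ∋ extra)
      extra∉ = ∖-elimʳ X W (proj₁ extra) (proj₂ extra) (proj₂ witness)
      extra-unique : ∀ x → X ∋ x → ¬ (W ∋ x) → x ≡ extra
      extra-unique x Xx ¬Wx = size≤1⇒unique (X ∖ W) (≤-reflexive ∣X∖W∣≡1) x extra (∖-intro X W x Xx ¬Wx) (proj₂ witness)

  oneMore-split : {X W : DiagSet n} (o : OneMore X W) → ∀ t → X ∋ t → (W ∋ t) ⊎ (t ≡ OneMore.extra o)
  oneMore-split {W = W} o t Xt with t ∈? W
  ... | yes Wt = inj₁ Wt
  ... | no ¬Wt = inj₂ (OneMore.extra-unique o t Xt ¬Wt)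

  adjacent-over : {X Y W : DiagSet n} → 4 ≤ n → Tri X → Tri Y → W ⊆ X → W ⊆ Y → size W ≡ n ∸ 4 →
    ∀ x → X ∋ x → ¬ (Y ∋ x) → Adjacent n X Y
  adjacent-over {X} {Y} {W} 4≤n tX tY W⊆X W⊆Y ∣W∣ x Xx ¬Yx = tX , tY , X≢Y , trans (card≡size (X ∩ Y)) (≤-antisym ≤n∸4 ≥n∸4)
    where
    X≢Y : ¬ SameSet X Y
    X≢Y s = ¬Yx (trans (sym (s (proj₁ x) (proj₂ x))) Xx)
    ≥n∸4 : n ∸ 4 ≤ size (X ∩ Y)
    ≥n∸4 = subst (_≤ size (X ∩ Y)) ∣W∣ (size-mono W (X ∩ Y) (λ i j h → ∩-intro X Y (i , j) (W⊆X i j h) (W⊆Y i j h)))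
    ≤n∸4 : size (X ∩ Y) ≤ n ∸ 4
    ≤n∸4 = +-cancelʳ-≤ 1 _ _ (begin
      size (X ∩ Y) + 1               ≤⟨ +-monoʳ-≤ (size (X ∩ Y)) (∋⇒size≥1 (X ∖ Y) x (∖-intro X Y x Xx ¬Yx)) ⟩
      size (X ∩ Y) + size (X ∖ Y)     ≡⟨ sym (size-split X Y) ⟩
      size X                          ≡⟨ tri-size tX ⟩
      n ∸ 3                           ≡⟨ ∸-suc n 3 4≤n ⟩
      suc (n ∸ 4)                     ≡⟨ +-comm 1 (n ∸ 4) ⟩
      n ∸ 4 + 1                       ∎)
      where open ≤-Reasoning

  insert-triangulation : (W : DiagSet n) → (∀ e → W ∋ e → Diagonal e) → (∀ e f → W ∋ e → W ∋ f → ¬ Crosses e f) →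
    size W ≡ n ∸ 4 → 4 ≤ n → ∀ x → Diagonal x → ¬ (W ∋ x) → (∀ t → W ∋ t → ¬ Crosses x t) → Tri (W ⊕ x)
  insert-triangulation W dW ncW ∣W∣ 4≤n x dx ¬Wx ncx =
    mkTri (W ⊕ x) (insert-diagonal W x dW dx)
      (λ e f → insert-noncrossing W x ncW ncx (proj₁ e) (proj₂ e) (proj₁ f) (proj₂ f))
      (trans (size-insert W x ¬Wx) (trans (cong suc ∣W∣) (sym (∸-suc n 3 4≤n))))

-- Quadrilaterals and the uniqueness of flips

module _ {n : ℕ} where
  same-chord : {x y k l : Fin n} → toℕ x ≡ toℕ k → toℕ y ≡ toℕ l → (x , y) ≡ (k , l)
  same-chord p q = cong₂ _,_ (FP.toℕ-injective p) (FP.toℕ-injective q)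

  sharing-endpoint-uncrossed : (i j k l : Fin n) →
    (toℕ i ≡ toℕ k) ⊎ (toℕ j ≡ toℕ l) ⊎ (toℕ j ≡ toℕ k) ⊎ (toℕ i ≡ toℕ l) → ¬ Cross i j k l
  sharing-endpoint-uncrossed i j k l (inj₁ e) (inj₁ (i<k , _)) = <-irrefl e i<k
  sharing-endpoint-uncrossed i j k l (inj₁ e) (inj₂ (k<i , _)) = <-irrefl (sym e) k<i
  sharing-endpoint-uncrossed i j k l (inj₂ (inj₁ e)) (inj₁ (_ , _ , j<l)) = <-irrefl e j<l
  sharing-endpoint-uncrossed i j k l (inj₂ (inj₁ e)) (inj₂ (_ , _ , l<j)) = <-irrefl (sym e) l<j
  sharing-endpoint-uncrossed i j k l (inj₂ (inj₂ (inj₁ e))) (inj₁ (_ , k<j , _)) = <-irrefl (sym e) k<j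
  sharing-endpoint-uncrossed i j k l (inj₂ (inj₂ (inj₁ e))) (inj₂ (k<i , i<l , l<j)) =
    <-asym (<-trans k<i i<l) (subst (toℕ l <_) e l<j)
  sharing-endpoint-uncrossed i j k l (inj₂ (inj₂ (inj₂ e))) (inj₁ (i<k , k<j , j<l)) =
    <-asym (<-trans k<j j<l) (subst (_< toℕ k) e i<k)
  sharing-endpoint-uncrossed i j k l (inj₂ (inj₂ (inj₂ e))) (inj₂ (_ , i<l , _)) = <-irrefl e i<l

module Quadrilateral {n : ℕ} (a b c e : Fin n) (a<b : toℕ a < toℕ b) (b<c : toℕ b < toℕ c) (c<e : toℕ c < toℕ e) where
  private
    anchors : List ℕ
    anchors = toℕ a ∷ toℕ b ∷ toℕ c ∷ toℕ e ∷ []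
    open Ranks anchors
    a<c = <-trans a<b b<c
    A : Anchor (toℕ a) 1
    A = rank-≡ _ _ , refl
    B : Anchor (toℕ b) 3
    B = rank-after _ a<b (rank-≡ _ _) , refl
    C : Anchor (toℕ c) 5
    C = rank-after _ a<c (rank-after _ b<c (rank-≡ _ _)) , refl
    E : Anchor (toℕ e) 7
    E = rank-after _ (<-trans a<c c<e) (rank-after _ (<-trans b<c c<e) (rank-after _ c<e (rank-≡ _ _))) , refl

  side : Fin 4 → Chord n
  side fz = a , b
  side (fs fz) = b , c
  side (fs (fs fz)) = c , e
  side (fs (fs (fs fz))) = a , e

  side-< : ∀ r → toℕ (proj₁ (side r)) < toℕ (proj₂ (side r))
  side-< fz = a<b
  side-< (fs fz) = b<c
  side-< (fs (fs fz)) = c<e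
  side-< (fs (fs (fs fz))) = <-trans a<b (<-trans b<c c<e)

  NoSides : Chord n → Set
  NoSides t = ∀ r → ¬ Crosses t (side r)

  noSides : ∀ t → toℕ (proj₁ t) ≤ toℕ (proj₂ t) → ¬ Crosses t (a , c) → ¬ Crosses t (b , e) → NoSides t
  noSides (x , y) x≤y ¬ac ¬be with at-chord anchors x≤y quadrilateral-sides (¬cross↑ A C ¬ac) (¬cross↑ B E ¬be)
  ... | ¬ab , ¬bc , ¬ce , ¬ae = λ where
    fz → ¬cross↓ A B ¬ab
    (fs fz) → ¬cross↓ B C ¬bc
    (fs (fs fz)) → ¬cross↓ C E ¬ce
    (fs (fs (fs fz))) → ¬cross↓ A E ¬ae

  other-diagonal : ∀ t → toℕ (proj₁ t) ≤ toℕ (proj₂ t) → NoSides t →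
    (Crosses t (a , c) → t ≡ (b , e)) × (Crosses t (b , e) → t ≡ (a , c))
  other-diagonal (x , y) x≤y ns with at-chord anchors x≤y quadrilateral-flip
    (¬cross↑ A B (ns fz)) (¬cross↑ B C (ns (fs fz))) (¬cross↑ C E (ns (fs (fs fz)))) (¬cross↑ A E (ns (fs (fs (fs fz)))))
  ... | to-be , to-ac =
    (λ x⋈ac → let p≡3 , q≡7 = to-be (cross↑ A C x⋈ac) in same-chord (anchor-injective B p≡3) (anchor-injective E q≡7)) ,
    (λ x⋈be → let p≡1 , q≡5 = to-ac (cross↑ B E x⋈be) in same-chord (anchor-injective A p≡1) (anchor-injective C q≡5))

  ac-noSides : NoSides (a , c)
  ac-noSides fz = sharing-endpoint-uncrossed a c a b (inj₁ refl)
  ac-noSides (fs fz) = sharing-endpoint-uncrossed a c b c (inj₂ (inj₁ refl))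
  ac-noSides (fs (fs fz)) = sharing-endpoint-uncrossed a c c e (inj₂ (inj₂ (inj₁ refl)))
  ac-noSides (fs (fs (fs fz))) = sharing-endpoint-uncrossed a c a e (inj₁ refl)

  be-noSides : NoSides (b , e)
  be-noSides fz = sharing-endpoint-uncrossed b e a b (inj₂ (inj₂ (inj₂ refl)))
  be-noSides (fs fz) = sharing-endpoint-uncrossed b e b c (inj₁ refl)
  be-noSides (fs (fs fz)) = sharing-endpoint-uncrossed b e c e (inj₂ (inj₁ refl))
  be-noSides (fs (fs (fs fz))) = sharing-endpoint-uncrossed b e a e (inj₂ (inj₁ refl))

  private
    ≢ₗ : ∀ {p q r s : Fin n} → toℕ p ≢ toℕ q → (p , r) ≢ (q , s)
    ≢ₗ ne = ne ∘ cong (toℕ ∘ proj₁)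
    ≢ᵣ : ∀ {p q r s : Fin n} → toℕ r ≢ toℕ s → (p , r) ≢ (q , s)
    ≢ᵣ ne = ne ∘ cong (toℕ ∘ proj₂)

  side≢ac : ∀ r → side r ≢ (a , c)
  side≢ac fz = ≢ᵣ (<⇒≢ b<c)
  side≢ac (fs fz) = ≢ₗ (>⇒≢ a<b)
  side≢ac (fs (fs fz)) = ≢ₗ (>⇒≢ (<-trans a<b b<c))
  side≢ac (fs (fs (fs fz))) = ≢ᵣ (>⇒≢ c<e)

  side≢be : ∀ r → side r ≢ (b , e)
  side≢be fz = ≢ₗ (<⇒≢ a<b)
  side≢be (fs fz) = ≢ᵣ (<⇒≢ c<e)
  side≢be (fs (fs fz)) = ≢ₗ (>⇒≢ b<c)
  side≢be (fs (fs (fs fz))) = ≢ₗ (<⇒≢ a<b)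

module _ {n : ℕ} where
  record Quad (x y : Chord n) : Set where
    field
      a b c e : Fin n
      a<b : toℕ a < toℕ b
      b<c : toℕ b < toℕ c
      c<e : toℕ c < toℕ e
      orient : ((x ≡ (a , c)) × (y ≡ (b , e))) ⊎ ((x ≡ (b , e)) × (y ≡ (a , c)))

  quad : ∀ x y → Crosses x y → Quad x y
  quad (i , j) (k , l) (inj₁ (i<k , k<j , j<l)) = record { a = i ; b = k ; c = j ; e = l ; a<b = i<k ; b<c = k<j ; c<e = j<l ; orient = inj₁ (refl , refl) }
  quad (i , j) (k , l) (inj₂ (k<i , i<l , l<j)) = record { a = k ; b = i ; c = l ; e = j ; a<b = k<i ; b<c = i<l ; c<e = l<j ; orient = inj₂ (refl , refl) }

module CrossingPair {n : ℕ} {x y : Chord n} (x⋈y : Crosses x y) where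
  open Quad (quad x y x⋈y) public
  open Quadrilateral a b c e a<b b<c c<e public

  noSides-xy : ∀ t → toℕ (proj₁ t) ≤ toℕ (proj₂ t) → ¬ Crosses t x → ¬ Crosses t y → NoSides t
  noSides-xy t t≤ ¬x ¬y with orient
  ... | inj₁ (x≡ , y≡) = noSides t t≤ (¬x ∘ subst (Crosses t) (sym x≡)) (¬y ∘ subst (Crosses t) (sym y≡))
  ... | inj₂ (x≡ , y≡) = noSides t t≤ (¬y ∘ subst (Crosses t) (sym y≡)) (¬x ∘ subst (Crosses t) (sym x≡))

  crossing-x : ∀ t → toℕ (proj₁ t) ≤ toℕ (proj₂ t) → NoSides t → Crosses t x → t ≡ y
  crossing-x t t≤ ns t⋈x with orient
  ... | inj₁ (x≡ , y≡) = trans (proj₁ (other-diagonal t t≤ ns) (subst (Crosses t) x≡ t⋈x)) (sym y≡)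
  ... | inj₂ (x≡ , y≡) = trans (proj₂ (other-diagonal t t≤ ns) (subst (Crosses t) x≡ t⋈x)) (sym y≡)

  crossing-y : ∀ t → toℕ (proj₁ t) ≤ toℕ (proj₂ t) → NoSides t → Crosses t y → t ≡ x
  crossing-y t t≤ ns t⋈y with orient
  ... | inj₁ (x≡ , y≡) = trans (proj₂ (other-diagonal t t≤ ns) (subst (Crosses t) y≡ t⋈y)) (sym x≡)
  ... | inj₂ (x≡ , y≡) = trans (proj₁ (other-diagonal t t≤ ns) (subst (Crosses t) y≡ t⋈y)) (sym x≡)

  x-noSides : NoSides x
  x-noSides with orient
  ... | inj₁ (x≡ , _) = subst NoSides (sym x≡) ac-noSides
  ... | inj₂ (x≡ , _) = subst NoSides (sym x≡) be-noSides

  side≢x : ∀ r → side r ≢ x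
  side≢x r with orient
  ... | inj₁ (x≡ , _) = λ p → side≢ac r (trans p x≡)
  ... | inj₂ (x≡ , _) = λ p → side≢be r (trans p x≡)

module _ {n : ℕ} where
  same-extra⇒same : {X Y W : DiagSet n} → W ⊆ X → W ⊆ Y → (oX : OneMore X W) (oY : OneMore Y W) →
    OneMore.extra oX ≡ OneMore.extra oY → SameSet X Y
  same-extra⇒same {X} {Y} {W} W⊆X W⊆Y oX oY eq = ⊆-antisym X Y (⊆other oX oY W⊆Y eq) (⊆other oY oX W⊆X (sym eq))
    where
    ⊆other : ∀ {P Q} (oP : OneMore P W) (oQ : OneMore Q W) → W ⊆ Q → OneMore.extra oP ≡ OneMore.extra oQ → P ⊆ Q
    ⊆other oP oQ W⊆Q eq i j h with oneMore-split oP (i , j) h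
    ... | inj₁ w = W⊆Q i j w
    ... | inj₂ p = ∋-subst (sym (trans p eq)) (OneMore.extra∈ oQ)

  extra-crossed : {X W : DiagSet n} → Tri X → (o : OneMore X W) → ∀ z → Diagonal z → ¬ (W ∋ z) → z ≢ OneMore.extra o →
    (∀ t → W ∋ t → ¬ Crosses z t) → Crosses z (OneMore.extra o)
  extra-crossed {X} {W} tX o z dz ¬Wz z≢x ncW with crosses? z (OneMore.extra o)
  ... | yes z⋈x = z⋈x
  ... | no ¬z⋈x = ⊥-elim (z≢x (OneMore.extra-unique o z (tri-maximal tX z dz ncX) ¬Wz))
    where
    ncX : ∀ t → X ∋ t → ¬ Crosses z t
    ncX t Xt with oneMore-split o t Xt
    ... | inj₁ Wt = ncW t Wt
    ... | inj₂ refl = ¬z⋈x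

module AroundFlip {n : ℕ} {X W : DiagSet n} (tX : Tri X) (o : OneMore X W) {y : Chord n}
  (x⋈y : Crosses (OneMore.extra o) y) (W-y : ∀ t → W ∋ t → ¬ Crosses t y) where
  open OneMore o
  open CrossingPair x⋈y public

  X-noSides : ∀ t → X ∋ t → NoSides t
  X-noSides t Xt with oneMore-split o t Xt
  ... | inj₁ Wt = noSides-xy t (diagonal-≤ t (tri-diagonal tX t Xt)) (tri-noncrossing tX t extra Xt extra∈) (W-y t Wt)
  ... | inj₂ refl = x-noSides

  sides-InOrSide : ∀ r → InOrSide X (side r)
  sides-InOrSide r = uncrossed⇒InOrSide tX (side r) (side-< r) (λ t Xt c → X-noSides t Xt r (crosses-sym (side r) t c))

  over-noSides : {Z : DiagSet n} → Tri Z → W ⊆ Z → ∀ z → Z ∋ z → NoSides z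
  over-noSides tZ W⊆Z z Zz r with sides-InOrSide r
  ... | inj₂ s = side-uncrossed (side r) z s
  ... | inj₁ Xs with oneMore-split o (side r) Xs
  ...   | inj₁ Ws = tri-noncrossing tZ z (side r) Zz (W⊆Z _ _ Ws)
  ...   | inj₂ p = ⊥-elim (side≢x r p)

module _ {n : ℕ} where
  at-most-two : {X Y Z W : DiagSet n} → 4 ≤ n → Tri X → Tri Y → Tri Z → W ⊆ X → W ⊆ Y → W ⊆ Z → size W ≡ n ∸ 4 →
    ¬ SameSet X Y → ¬ SameSet X Z → ¬ SameSet Y Z → ⊥
  at-most-two {X} {Y} {Z} {W} 4≤n tX tY tZ W⊆X W⊆Y W⊆Z ∣W∣ X≢Y X≢Z Y≢Z = z≢y (crossing-x z z≤ (over-noSides tZ W⊆Z z Zz) z⋈x)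
    where
    oX = oneMore 4≤n tX W⊆X ∣W∣
    oY = oneMore 4≤n tY W⊆Y ∣W∣
    oZ = oneMore 4≤n tZ W⊆Z ∣W∣
    open OneMore oY using () renaming (extra to y; extra∈ to Yy; extra∉ to ¬Wy)
    open OneMore oZ using () renaming (extra to z; extra∈ to Zz; extra∉ to ¬Wz)
    x = OneMore.extra oX
    z≢y : z ≢ y
    z≢y p = Y≢Z (same-extra⇒same W⊆Y W⊆Z oY oZ (sym p))
    crossed : ∀ {V} (tV : Tri V) (W⊆V : W ⊆ V) (oV : OneMore V W) → ¬ SameSet X V → Crosses (OneMore.extra oV) x
    crossed tV W⊆V oV X≢V = extra-crossed tX oX _ (tri-diagonal tV _ (OneMore.extra∈ oV)) (OneMore.extra∉ oV)
      (λ p → X≢V (same-extra⇒same W⊆X W⊆V oX oV (sym p)))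
      (λ t Wt → tri-noncrossing tV _ t (OneMore.extra∈ oV) (W⊆V _ _ Wt))
    z⋈x = crossed tZ W⊆Z oZ X≢Z
    z≤ = diagonal-≤ z (tri-diagonal tZ z Zz)
    open AroundFlip tX oX (crosses-sym y x (crossed tY W⊆Y oY X≢Y)) (λ t Wt → tri-noncrossing tY t y (W⊆Y _ _ Wt) Yy)

  third-equal : {X Y Z W : DiagSet n} → 4 ≤ n → Tri X → Tri Y → Tri Z → W ⊆ X → W ⊆ Y → W ⊆ Z → size W ≡ n ∸ 4 →
    ¬ SameSet X Y → ¬ SameSet X Z → SameSet Y Z
  third-equal {X} {Y} {Z} {W} 4≤n tX tY tZ W⊆X W⊆Y W⊆Z ∣W∣ X≢Y X≢Z = compare (oneMore 4≤n tY W⊆Y ∣W∣) (oneMore 4≤n tZ W⊆Z ∣W∣)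
    where
    compare : OneMore Y W → OneMore Z W → SameSet Y Z
    compare oY oZ with OneMore.extra oY ≟ᶜ OneMore.extra oZ
    ... | yes p = same-extra⇒same W⊆Y W⊆Z oY oZ p
    ... | no ¬p = ⊥-elim (at-most-two 4≤n tX tY tZ W⊆X W⊆Y W⊆Z ∣W∣ X≢Y X≢Z Y≢Z)
      where
      Y≢Z : ¬ SameSet Y Z
      Y≢Z s with oneMore-split oZ (OneMore.extra oY) (trans (sym (s _ _)) (OneMore.extra∈ oY))
      ... | inj₁ w = OneMore.extra∉ oY w
      ... | inj₂ p = ¬p p

  adj-triˡ : {X Y : DiagSet n} → Adjacent n X Y → Tri X
  adj-triˡ = proj₁

  adj-triʳ : {X Y : DiagSet n} → Adjacent n X Y → Tri Y
  adj-triʳ = proj₁ ∘ proj₂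

  adj-≢ : {X Y : DiagSet n} → Adjacent n X Y → ¬ SameSet X Y
  adj-≢ = proj₁ ∘ proj₂ ∘ proj₂

  adj-≢′ : {X Y : DiagSet n} → Adjacent n X Y → ¬ SameSet Y X
  adj-≢′ {X} {Y} a s = adj-≢ a (same-sym Y X s)

  adj-size : {X Y : DiagSet n} → Adjacent n X Y → size (X ∩ Y) ≡ n ∸ 4
  adj-size {X} {Y} a = trans (sym (card≡size (X ∩ Y))) (proj₂ (proj₂ (proj₂ a)))

-- Pentagons and their fans

module _ {n : ℕ} where
  ∩-cong : (X X′ Y Y′ : DiagSet n) → SameSet X X′ → SameSet Y Y′ → SameSet (X ∩ Y) (X′ ∩ Y′)
  ∩-cong X X′ Y Y′ sX sY i j = trans (∩≡∧ X Y) (trans (cong₂ _∧_ (sX i j) (sY i j)) (sym (∩≡∧ X′ Y′)))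
    where
    ∩≡∧ : (P Q : DiagSet n) → (P ∩ Q) i j ≡ P i j ∧ Q i j
    ∩≡∧ P Q with P i j
    ... | true = refl
    ... | false = refl

  tri-cong : (X X′ : DiagSet n) → SameSet X X′ → Tri X → Tri X′
  tri-cong X X′ s t = (λ i j h → proj₁ t i j (trans (s i j) h)) ,
                      (λ i j k l h₁ h₂ → proj₁ (proj₂ t) i j k l (trans (s i j) h₁) (trans (s k l) h₂)) ,
                      trans (card≡size X′) (trans (sym (size-cong X X′ s)) (tri-size t))

  adj-cong : (X X′ Y Y′ : DiagSet n) → SameSet X X′ → SameSet Y Y′ → Adjacent n X Y → Adjacent n X′ Y′
  adj-cong X X′ Y Y′ sX sY a = tri-cong X X′ sX (adj-triˡ a) , tri-cong Y Y′ sY (adj-triʳ a) ,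
    (λ s → adj-≢ a (same-trans X X′ Y sX (same-trans X′ Y′ Y s (same-sym Y Y′ sY)))) ,
    trans (card≡size (X′ ∩ Y′)) (trans (sym (size-cong _ _ (∩-cong X X′ Y Y′ sX sY))) (trans (sym (card≡size (X ∩ Y))) (proj₂ (proj₂ (proj₂ a)))))

  adj-sym : (X Y : DiagSet n) → Adjacent n X Y → Adjacent n Y X
  adj-sym X Y a = adj-triʳ a , adj-triˡ a , adj-≢′ a ,
    trans (card≡size (Y ∩ X)) (trans (size-cong _ _ (∩-comm Y X)) (trans (sym (card≡size (X ∩ Y))) (proj₂ (proj₂ (proj₂ a)))))

  same-≢-congˡ : (X X′ Y : DiagSet n) → SameSet X X′ → ¬ SameSet X Y → ¬ SameSet X′ Y
  same-≢-congˡ X X′ Y s X≢Y s′ = X≢Y (same-trans X X′ Y s s′)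

  same-≢-sym : (X Y : DiagSet n) → ¬ SameSet X Y → ¬ SameSet Y X
  same-≢-sym X Y X≢Y s = X≢Y (same-sym Y X s)

  cycle-cong : (T T′ U U′ : DiagSet n) → SameSet T T′ → SameSet U U′ → FiveCycleThrough n T U → FiveCycleThrough n T′ U′
  cycle-cong T T′ U U′ sT sU c = cyc A B C (adj-cong U U′ A A sU (λ _ _ → refl) adjUA) adjAB adjBC (adj-cong C C T T′ (λ _ _ → refl) sT adjCT)
    (same-≢-congˡ T T′ A sT T≢A) (same-≢-congˡ T T′ B sT T≢B) (same-≢-congˡ U U′ B sU U≢B) (same-≢-congˡ U U′ C sU U≢C) A≢C
    where open FiveCycleThrough c

  cycle-reverse : (T U : DiagSet n) → FiveCycleThrough n T U → FiveCycleThrough n U T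
  cycle-reverse T U c = cyc C B A (adj-sym C T adjCT) (adj-sym B C adjBC) (adj-sym A B adjAB) (adj-sym U A adjUA)
    U≢C U≢B T≢B T≢A (same-≢-sym A C A≢C)
    where open FiveCycleThrough c

next : Fin 5 → Fin 5
next fz = fs fz
next (fs fz) = fs (fs fz)
next (fs (fs fz)) = fs (fs (fs fz))
next (fs (fs (fs fz))) = fs (fs (fs (fs fz)))
next (fs (fs (fs (fs fz)))) = fz

next⁵ : ∀ s → next (next (next (next (next s)))) ≡ s
next⁵ = from-yes (FP.all? λ s → next (next (next (next (next s)))) FP.≟ s)

next-distinct : ∀ s → s ≢ next s × s ≢ next (next s) × s ≢ next (next (next s))
next-distinct = from-yes (FP.all? λ s → ¬? (s FP.≟ next s) ×-dec ¬? (s FP.≟ next (next s)) ×-dec ¬? (s FP.≟ next (next (next s))))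

-- Consecutive vertices of the walk differ by adjacency, so distinctness at distance two makes it a 5-cycle.
record FiveCycle (n : ℕ) : Set where
  field
    X : Fin 5 → DiagSet n
    adjacent : ∀ s → Adjacent n (X s) (X (next s))
    distinct : ∀ s → ¬ SameSet (X s) (X (next (next s)))

  through : (s : Fin 5) → FiveCycleThrough n (X s) (X (next s))
  through s = cyc (X s₂) (X s₃) (X s₄) (adjacent s₁) (adjacent s₂) (adjacent s₃)
      (adj-cong (X s₄) (X s₄) (X (next s₄)) (X s) (λ _ _ → refl) (λ i j → cong (λ v → X v i j) (next⁵ s)) (adjacent s₄))
      (distinct s)
      (same-≢-sym (X s₃) (X s) (λ p → distinct s₃ (same-trans _ _ _ p (λ i j → cong (λ v → X v i j) (sym (next⁵ s))))))
      (distinct s₁)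
      (same-≢-sym (X s₄) (X s₁) (λ p → distinct s₄ (same-trans _ _ _ p (λ i j → cong (λ v → X v i j) (sym (cong next (next⁵ s)))))))
      (distinct s₂)
    where
    s₁ = next s
    s₂ = next s₁
    s₃ = next s₂
    s₄ = next s₃

rankOf : Fin 5 → ℕ
rankOf k = suc (2 * toℕ k)

diagIdx : Fin 5 → Fin 5 × Fin 5
diagIdx fz = fz , fs (fs fz)
diagIdx (fs fz) = fz , fs (fs (fs fz))
diagIdx (fs (fs fz)) = fs fz , fs (fs (fs fz))
diagIdx (fs (fs (fs fz))) = fs fz , fs (fs (fs (fs fz)))
diagIdx (fs (fs (fs (fs fz)))) = fs (fs fz) , fs (fs (fs (fs fz)))

sideIdx : Fin 5 → Fin 5 × Fin 5
sideIdx fz = fz , fs fz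
sideIdx (fs fz) = fs fz , fs (fs fz)
sideIdx (fs (fs fz)) = fs (fs fz) , fs (fs (fs fz))
sideIdx (fs (fs (fs fz))) = fs (fs (fs fz)) , fs (fs (fs (fs fz)))
sideIdx (fs (fs (fs (fs fz)))) = fz , fs (fs (fs (fs fz)))

CrossAt : ℕ → ℕ → Fin 5 × Fin 5 → Set
CrossAt p q kl = Crossℕ p q (rankOf (proj₁ kl)) (rankOf (proj₂ kl))

crossAt? : ∀ p q kl → Dec (CrossAt p q kl)
crossAt? p q kl = crossℕ? p q (rankOf (proj₁ kl)) (rankOf (proj₂ kl))

CrossIdx : Fin 5 × Fin 5 → Fin 5 × Fin 5 → Set
CrossIdx ij = CrossAt (rankOf (proj₁ ij)) (rankOf (proj₂ ij))

crossIdx? : ∀ ij kl → Dec (CrossIdx ij kl)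
crossIdx? ij = crossAt? (rankOf (proj₁ ij)) (rankOf (proj₂ ij))

fan-covers : ∀ s k → (k ≡ s) ⊎ (k ≡ next s) ⊎ CrossIdx (diagIdx k) (diagIdx s) ⊎ CrossIdx (diagIdx k) (diagIdx (next s))
fan-covers = from-yes (FP.all? λ s → FP.all? λ k →
  k FP.≟ s ⊎-dec k FP.≟ next s ⊎-dec crossIdx? (diagIdx k) (diagIdx s) ⊎-dec crossIdx? (diagIdx k) (diagIdx (next s)))

consecutive-uncrossed : ∀ s → ¬ CrossIdx (diagIdx (next s)) (diagIdx s)
consecutive-uncrossed = from-yes (FP.all? λ s → ¬? (crossIdx? (diagIdx (next s)) (diagIdx s)))

diagIdx-injective : ∀ k l → rankOf (proj₁ (diagIdx k)) ≡ rankOf (proj₁ (diagIdx l)) →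
  rankOf (proj₂ (diagIdx k)) ≡ rankOf (proj₂ (diagIdx l)) → k ≡ l
diagIdx-injective = from-yes (FP.all? λ k → FP.all? λ l →
  rankOf (proj₁ (diagIdx k)) ≟ rankOf (proj₁ (diagIdx l)) →-dec rankOf (proj₂ (diagIdx k)) ≟ rankOf (proj₂ (diagIdx l)) →-dec k FP.≟ l)

pentagon-exterior : Upto 10 λ p q → (∀ k → ¬ CrossAt p q (sideIdx k)) →
  (∀ k → ¬ (p ≡ rankOf (proj₁ (diagIdx k)) × q ≡ rankOf (proj₂ (diagIdx k)))) → ∀ k → ¬ CrossAt p q (diagIdx k)
pentagon-exterior = from-yes (upto? 10 λ p q → FP.all? (λ k → ¬? (crossAt? p q (sideIdx k))) →-dec
  FP.all? (λ k → ¬? (p ≟ rankOf (proj₁ (diagIdx k)) ×-dec q ≟ rankOf (proj₂ (diagIdx k)))) →-dec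
  FP.all? (λ k → ¬? (crossAt? p q (diagIdx k))))

module ConvexPentagon {n : ℕ} (5≤n : 5 ≤ n) (v₀ v₁ v₂ v₃ v₄ : Fin n)
  (v₀<v₁ : toℕ v₀ < toℕ v₁) (v₁<v₂ : toℕ v₁ < toℕ v₂) (v₂<v₃ : toℕ v₂ < toℕ v₃) (v₃<v₄ : toℕ v₃ < toℕ v₄)
  {X : DiagSet n} (tX : Tri X) {W : DiagSet n} (W⊆X : W ⊆ X) (∣W∣ : size W ≡ n ∸ 5) where

  vertex : Fin 5 → Fin n
  vertex fz = v₀
  vertex (fs fz) = v₁
  vertex (fs (fs fz)) = v₂
  vertex (fs (fs (fs fz))) = v₃
  vertex (fs (fs (fs (fs fz)))) = v₄

  chord : Fin 5 × Fin 5 → Chord n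
  chord ij = vertex (proj₁ ij) , vertex (proj₂ ij)

  diag : Fin 5 → Chord n
  diag k = chord (diagIdx k)

  edge : Fin 5 → Chord n
  edge k = chord (sideIdx k)

  private
    v₄<n : toℕ v₄ < n
    v₄<n = FP.toℕ<n v₄

    ≢0 : ∀ {x} → toℕ v₀ < x → x ≢ 0
    ≢0 lt e = <⇒≱ lt (subst (_≤ toℕ v₀) (sym e) z≤n)

    diagonal : ∀ (a b c : Fin n) → toℕ a < toℕ b → toℕ b < toℕ c → (toℕ a ≢ 0 ⊎ suc (toℕ c) < n) → Diagonal (a , c)
    diagonal a b c a<b b<c not-outer = subst (_≤ toℕ c) (+-comm 2 (toℕ a)) (≤-trans (s≤s a<b) b<c) , λ (a≡0 , 1+c≡n) → excluded not-outer a≡0 1+c≡n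
      where
      excluded : (toℕ a ≢ 0 ⊎ suc (toℕ c) < n) → toℕ a ≡ 0 → suc (toℕ c) ≡ n → ⊥
      excluded (inj₁ a≢0) a≡0 _ = a≢0 a≡0
      excluded (inj₂ lt) _ 1+c≡n = <-irrefl 1+c≡n lt

    anchors : List ℕ
    anchors = toℕ v₀ ∷ toℕ v₁ ∷ toℕ v₂ ∷ toℕ v₃ ∷ toℕ v₄ ∷ []
    open Ranks anchors

    v₀<v₂ = <-trans v₀<v₁ v₁<v₂
    v₁<v₃ = <-trans v₁<v₂ v₂<v₃
    v₂<v₄ = <-trans v₂<v₃ v₃<v₄

    anchored : ∀ i → Anchor (toℕ (vertex i)) (rankOf i)
    anchored fz = rank-≡ _ _ , refl
    anchored (fs fz) = rank-after _ v₀<v₁ (rank-≡ _ _) , refl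
    anchored (fs (fs fz)) = rank-after _ v₀<v₂ (rank-after _ v₁<v₂ (rank-≡ _ _)) , refl
    anchored (fs (fs (fs fz))) =
      rank-after _ (<-trans v₀<v₁ v₁<v₃) (rank-after _ v₁<v₃ (rank-after _ v₂<v₃ (rank-≡ _ _))) , refl
    anchored (fs (fs (fs (fs fz)))) =
      rank-after _ (<-trans v₀<v₂ v₂<v₄) (rank-after _ (<-trans v₁<v₂ v₂<v₄)
        (rank-after _ v₂<v₄ (rank-after _ v₃<v₄ (rank-≡ _ _)))) , refl

  crossIdx⇒crosses : ∀ ij kl → CrossIdx ij kl → Crosses (chord ij) (chord kl)
  crossIdx⇒crosses ij kl c = cross↓ (anchored (proj₁ kl)) (anchored (proj₂ kl))
    (subst₂ (λ p q → Crossℕ p q _ _) (sym (proj₁ (anchored (proj₁ ij)))) (sym (proj₁ (anchored (proj₂ ij)))) c)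

  ¬crossIdx⇒¬crosses : ∀ ij kl → ¬ CrossIdx ij kl → ¬ Crosses (chord ij) (chord kl)
  ¬crossIdx⇒¬crosses ij kl ¬c c = ¬c (subst₂ (λ p q → Crossℕ p q _ _) (proj₁ (anchored (proj₁ ij))) (proj₁ (anchored (proj₂ ij)))
    (cross↑ (anchored (proj₁ kl)) (anchored (proj₂ kl)) c))

  diag-injective : ∀ k l → diag k ≡ diag l → k ≡ l
  diag-injective k l p = diagIdx-injective k l (same-rank (cong proj₁ p)) (same-rank (cong proj₂ p))
    where
    same-rank : ∀ {i j} → vertex i ≡ vertex j → rankOf i ≡ rankOf j
    same-rank {i} {j} q = trans (sym (proj₁ (anchored i))) (trans (cong (rank anchors ∘ toℕ) q) (proj₁ (anchored j)))

  diag-Diagonal : ∀ k → Diagonal (diag k)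
  diag-Diagonal fz = diagonal v₀ v₁ v₂ v₀<v₁ v₁<v₂ (inj₂ (≤-trans (s≤s (<-trans v₂<v₃ v₃<v₄)) v₄<n))
  diag-Diagonal (fs fz) = diagonal v₀ v₁ v₃ v₀<v₁ v₁<v₃ (inj₂ (≤-trans (s≤s v₃<v₄) v₄<n))
  diag-Diagonal (fs (fs fz)) = diagonal v₁ v₂ v₃ v₁<v₂ v₂<v₃ (inj₁ (≢0 v₀<v₁))
  diag-Diagonal (fs (fs (fs fz))) = diagonal v₁ v₂ v₄ v₁<v₂ v₂<v₄ (inj₁ (≢0 v₀<v₁))
  diag-Diagonal (fs (fs (fs (fs fz)))) = diagonal v₂ v₃ v₄ v₂<v₃ v₃<v₄ (inj₁ (≢0 v₀<v₂))

  module Fan (s₀ : Fin 5) (X∋s₀ : X ∋ diag s₀) (X∋s₁ : X ∋ diag (next s₀)) (W∌s₀ : ¬ (W ∋ diag s₀)) (W∌s₁ : ¬ (W ∋ diag (next s₀)))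
             (edges : ∀ k → InOrSide X (edge k)) where

    diag∉W : ∀ k → ¬ (W ∋ diag k)
    diag∉W k Wk with fan-covers s₀ k
    ... | inj₁ refl = W∌s₀ Wk
    ... | inj₂ (inj₁ refl) = W∌s₁ Wk
    ... | inj₂ (inj₂ (inj₁ c)) = tri-noncrossing tX (diag k) (diag s₀) (W⊆X _ _ Wk) X∋s₀ (crossIdx⇒crosses _ _ c)
    ... | inj₂ (inj₂ (inj₂ c)) = tri-noncrossing tX (diag k) (diag (next s₀)) (W⊆X _ _ Wk) X∋s₁ (crossIdx⇒crosses _ _ c)

    W-uncrossed : ∀ w → W ∋ w → ∀ k → ¬ Crosses w (diag k)
    W-uncrossed (x , y) Ww k = ¬cross↓ (anchored _) (anchored _)
      (at-chord anchors (diagonal-≤ (x , y) (tri-diagonal tX _ Xw)) pentagon-exterior no-edge not-diag k)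
      where
      Xw : X ∋ (x , y)
      Xw = W⊆X _ _ Ww
      no-edge : ∀ k → ¬ CrossAt (rank anchors (toℕ x)) (rank anchors (toℕ y)) (sideIdx k)
      no-edge k = ¬cross↑ (anchored _) (anchored _) (inOrSide-uncrossed tX (edge k) (x , y) (edges k) Xw)
      not-diag : ∀ k → ¬ (rank anchors (toℕ x) ≡ rankOf (proj₁ (diagIdx k)) × rank anchors (toℕ y) ≡ rankOf (proj₂ (diagIdx k)))
      not-diag k (p , q) = diag∉W k (∋-subst {X = W} (same-chord (anchor-injective (anchored _) p) (anchor-injective (anchored _) q)) Ww)

    half : Fin 5 → DiagSet n
    half s = W ⊕ diag s

    fan : Fin 5 → DiagSet n
    fan s = half s ⊕ diag (next s)

    ∣half∣ : ∀ s → size (half s) ≡ n ∸ 4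
    ∣half∣ s = trans (size-insert W (diag s) (diag∉W s)) (trans (cong suc ∣W∣) (sym (∸-suc n 4 5≤n)))

    half-noncrossing : ∀ s e f → half s ∋ e → half s ∋ f → ¬ Crosses e f
    half-noncrossing s e f he hf = insert-noncrossing W (diag s) (λ e f We Wf → tri-noncrossing tX e f (W⊆X _ _ We) (W⊆X _ _ Wf))
      (λ t Wt c → W-uncrossed t Wt s (crosses-sym (diag s) t c)) (proj₁ e) (proj₂ e) (proj₁ f) (proj₂ f) he hf

    fan-tri : ∀ s → Tri (fan s)
    fan-tri s = insert-triangulation (half s) (insert-diagonal W (diag s) (λ e We → tri-diagonal tX e (W⊆X _ _ We)) (diag-Diagonal s))
      (half-noncrossing s) (∣half∣ s) (≤-trans (n≤1+n 4) 5≤n) (diag (next s)) (diag-Diagonal (next s)) next∉ next-uncrossed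
      where
      next∉ : ¬ (half s ∋ diag (next s))
      next∉ h with ⊕-elim W (diag s) _ _ h
      ... | inj₁ p = proj₁ (next-distinct s) (sym (diag-injective _ _ p))
      ... | inj₂ Wt = diag∉W (next s) Wt
      next-uncrossed : ∀ t → half s ∋ t → ¬ Crosses (diag (next s)) t
      next-uncrossed t h with ⊕-elim W (diag s) _ _ h
      ... | inj₁ refl = ¬crossIdx⇒¬crosses _ _ (consecutive-uncrossed s)
      ... | inj₂ Wt = W-uncrossed t Wt (next s) ∘ crosses-sym (diag (next s)) t

    fan-cases : ∀ s e → fan s ∋ e → (W ∋ e) ⊎ (e ≡ diag s) ⊎ (e ≡ diag (next s))
    fan-cases s e h with ⊕-elim (half s) (diag (next s)) _ _ h
    ... | inj₁ p = inj₂ (inj₂ p)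
    ... | inj₂ h′ with ⊕-elim W (diag s) _ _ h′
    ...   | inj₁ p = inj₂ (inj₁ p)
    ...   | inj₂ Wt = inj₁ Wt

    W⊆fan : ∀ s → W ⊆ fan s
    W⊆fan s i j h = ⊕-old (half s) (diag (next s)) i j (⊕-old W (diag s) i j h)

    fan∋diag : ∀ s → fan s ∋ diag s
    fan∋diag s = ⊕-old (half s) (diag (next s)) _ _ (⊕-new W (diag s))

    fan∋next : ∀ s → fan s ∋ diag (next s)
    fan∋next s = ⊕-new (half s) (diag (next s))

    fan∌ : ∀ s k → k ≢ s → k ≢ next s → ¬ (fan s ∋ diag k)
    fan∌ s k k≢s k≢s′ h with fan-cases s (diag k) h
    ... | inj₁ Wk = diag∉W k Wk
    ... | inj₂ (inj₁ p) = k≢s (diag-injective _ _ p)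
    ... | inj₂ (inj₂ p) = k≢s′ (diag-injective _ _ p)

    fan-adjacent : ∀ s → Adjacent n (fan s) (fan (next s))
    fan-adjacent s = adjacent-over (≤-trans (n≤1+n 4) 5≤n) (fan-tri s) (fan-tri (next s)) half⊆fan (⊕-old _ _) (∣half∣ (next s))
      (diag s) (fan∋diag s) (fan∌ (next s) s (proj₁ (next-distinct s)) (proj₁ (proj₂ (next-distinct s))))
      where
      half⊆fan : half (next s) ⊆ fan s
      half⊆fan i j h with ⊕-elim W (diag (next s)) i j h
      ... | inj₁ refl = fan∋next s
      ... | inj₂ Wt = W⊆fan s i j Wt

    fan-distinct : ∀ s → ¬ SameSet (fan s) (fan (next (next s)))
    fan-distinct s same = fan∌ (next (next s)) s (proj₁ (proj₂ (next-distinct s))) (proj₂ (proj₂ (next-distinct s)))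
      (trans (sym (same (proj₁ (diag s)) (proj₂ (diag s)))) (fan∋diag s))

    fans : FiveCycle n
    fans = record { X = fan ; adjacent = fan-adjacent ; distinct = fan-distinct }

    fan-unique : ∀ {Y : DiagSet n} → Tri Y → W ⊆ Y → ∀ s → Y ∋ diag s → Y ∋ diag (next s) → SameSet Y (fan s)
    fan-unique {Y} tY W⊆Y s Ys Ys′ = ⊆-antisym Y (fan s) (size-≤⇒⊇ (fan s) Y fan⊆Y (≤-reflexive (trans (tri-size tY) (sym (tri-size (fan-tri s)))))) fan⊆Y
      where
      fan⊆Y : fan s ⊆ Y
      fan⊆Y i j h with fan-cases s (i , j) h
      ... | inj₁ Wt = W⊆Y i j Wt
      ... | inj₂ (inj₁ p) = ∋-subst {X = Y} (sym p) Ys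
      ... | inj₂ (inj₂ p) = ∋-subst {X = Y} (sym p) Ys′

least : {n : ℕ} (P : Fin n → Set) → (∀ q → Dec (P q)) → ∃ P → ∃ λ q → P q × (∀ q′ → P q′ → toℕ q ≤ toℕ q′)
least {suc n} P P? w with P? fz
... | yes p = fz , p , (λ _ _ → z≤n)
... | no ¬p with w
...   | fz , p = ⊥-elim (¬p p)
...   | fs q , p with least (P ∘ fs) (P? ∘ fs) (q , p)
...     | r , pr , minimal = fs r , pr , minimal′
  where
  minimal′ : ∀ q′ → P q′ → toℕ (fs r) ≤ toℕ q′
  minimal′ fz pq = ⊥-elim (¬p pq)
  minimal′ (fs q′) pq = s≤s (minimal q′ pq)

greatest : {n : ℕ} (P : Fin n → Set) → (∀ q → Dec (P q)) → ∃ P → ∃ λ q → P q × (∀ q′ → P q′ → toℕ q′ ≤ toℕ q)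
greatest {suc n} P P? w with FP.any? (P? ∘ fs)
... | yes (q , p) with greatest (P ∘ fs) (P? ∘ fs) (q , p)
...   | r , pr , maximal = fs r , pr , maximal′
  where
  maximal′ : ∀ q′ → P q′ → toℕ q′ ≤ toℕ (fs r)
  maximal′ fz _ = z≤n
  maximal′ (fs q′) pq = s≤s (maximal q′ pq)
greatest {suc n} P P? (fz , p) | no none = fz , p , maximal′
  where
  maximal′ : ∀ q′ → P q′ → toℕ q′ ≤ 0
  maximal′ fz _ = z≤n
  maximal′ (fs q′) pq = ⊥-elim (none (q′ , pq))
greatest {suc n} P P? (fs q , p) | no none = ⊥-elim (none (q , p))

module Triangle {n : ℕ} (a p b : Fin n) (a<p : toℕ a < toℕ p) (p<b : toℕ p < toℕ b) where
  private
    anchors : List ℕ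
    anchors = toℕ a ∷ toℕ p ∷ toℕ b ∷ []
    open Ranks anchors
    A : Anchor (toℕ a) 1
    A = rank-≡ _ _ , refl
    P : Anchor (toℕ p) 3
    P = rank-after _ a<p (rank-≡ _ _) , refl
    B : Anchor (toℕ b) 5
    B = rank-after _ (<-trans a<p p<b) (rank-after _ p<b (rank-≡ _ _)) , refl

  across-pb : ∀ x y → toℕ x ≤ toℕ y → ¬ Cross x y a b → ¬ Cross x y a p → Cross x y p b →
    x ≡ a × toℕ p < toℕ y × toℕ y < toℕ b
  across-pb x y x≤y ¬ab ¬ap pb with at-chord anchors x≤y triangle-inner (¬cross↑ A B ¬ab) (¬cross↑ A P ¬ap) (cross↑ P B pb)
  ... | x↦1 , y↦4 = FP.toℕ-injective (anchor-injective A x↦1) ,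
                    anchor-<⁻¹ P (subst (3 <_) (sym y↦4) ≤-refl) , <-anchor⁻¹ B (subst (_< 5) (sym y↦4) ≤-refl)

  across-ab : ∀ x y → toℕ x ≤ toℕ y → ¬ Cross x y p b → ¬ Cross x y a p → Cross x y a b →
    (x ≡ p × toℕ b < toℕ y) ⊎ (y ≡ p × toℕ x < toℕ a)
  across-ab x y x≤y ¬pb ¬ap ab with at-chord anchors x≤y triangle-outer (¬cross↑ P B ¬pb) (¬cross↑ A P ¬ap) (cross↑ A B ab)
  ... | inj₁ (x↦3 , y↦6) = inj₁ (FP.toℕ-injective (anchor-injective P x↦3) , anchor-<⁻¹ B (subst (5 <_) (sym y↦6) ≤-refl))
  ... | inj₂ (x↦0 , y↦3) = inj₂ (FP.toℕ-injective (anchor-injective P y↦3) , <-anchor⁻¹ A (subst (_< 1) (sym x↦0) ≤-refl))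

-- The two triangles of T on a diagonal (a , b): one with apex between a and b, one with apex outside.
module TrianglesOn {n : ℕ} {T : DiagSet n} (tT : Tri T) where
  private
    side? : ∀ e → Dec (Side e)
    side? (i , j) = toℕ j ≟ suc (toℕ i) ⊎-dec (toℕ i ≟ 0 ×-dec suc (toℕ j) ≟ n)

    inOrSide? : ∀ e → Dec (InOrSide T e)
    inOrSide? e = e ∈? T ⊎-dec side? e

    uncrossed : ∀ {a p} (ap : InOrSide T (a , p)) → ∀ x y → T ∋ (x , y) → ¬ Cross x y a p
    uncrossed ap x y Txy = inOrSide-uncrossed tT _ (x , y) ap Txy

  inner : ∀ a b → T ∋ (a , b) → ∃ λ p → (toℕ a < toℕ p) × (toℕ p < toℕ b) × InOrSide T (a , p) × InOrSide T (p , b)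
  inner a b Tab = p , a<p , p<b , ap , uncrossed⇒InOrSide tT (p , b) p<b pb-uncrossed
    where
    a+2≤b : suc (suc (toℕ a)) ≤ toℕ b
    a+2≤b = subst (_≤ toℕ b) (+-comm (toℕ a) 2) (proj₁ (tri-diagonal tT (a , b) Tab))
    Joined : Fin n → Set
    Joined q = (toℕ a < toℕ q) × (toℕ q < toℕ b) × InOrSide T (a , q)
    a+1 : Fin n
    a+1 = fromℕ< (<-trans a+2≤b (FP.toℕ<n b))
    a+1≡ : toℕ a+1 ≡ suc (toℕ a)
    a+1≡ = FP.toℕ-fromℕ< _
    best = greatest Joined (λ q → toℕ a <? toℕ q ×-dec toℕ q <? toℕ b ×-dec inOrSide? (a , q))
      (a+1 , subst (toℕ a <_) (sym a+1≡) ≤-refl , subst (_< toℕ b) (sym a+1≡) a+2≤b , inj₂ (inj₁ a+1≡))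
    p = proj₁ best
    a<p = proj₁ (proj₁ (proj₂ best))
    p<b = proj₁ (proj₂ (proj₁ (proj₂ best)))
    ap = proj₂ (proj₂ (proj₁ (proj₂ best)))
    pb-uncrossed : ∀ t → T ∋ t → ¬ Crosses (p , b) t
    pb-uncrossed (x , y) Txy pb⋈xy with Triangle.across-pb a p b a<p p<b x y (diagonal-≤ _ (tri-diagonal tT _ Txy))
      (tri-noncrossing tT (x , y) (a , b) Txy Tab) (uncrossed ap x y Txy) (crosses-sym (p , b) (x , y) pb⋈xy)
    ... | refl , p<y , y<b = <⇒≱ p<y (proj₂ (proj₂ best) y (<-trans a<p p<y , y<b , inj₁ Txy))

  OuterApex : Fin n → Fin n → Set
  OuterApex a b = ∃ λ p → ((toℕ b < toℕ p) × InOrSide T (a , p) × InOrSide T (b , p))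
                    ⊎ ((toℕ p < toℕ a) × InOrSide T (p , a) × InOrSide T (p , b))

  outer : ∀ a b → T ∋ (a , b) → OuterApex a b
  outer a b Tab with FP.any? (λ q → toℕ b <? toℕ q ×-dec inOrSide? (a , q))
  ... | yes w = p , inj₁ (b<p , ap , uncrossed⇒InOrSide tT (b , p) b<p bp-uncrossed)
    where
    a<b = diagonal-< (a , b) (tri-diagonal tT (a , b) Tab)
    best = least (λ q → (toℕ b < toℕ q) × InOrSide T (a , q)) (λ q → toℕ b <? toℕ q ×-dec inOrSide? (a , q)) w
    p = proj₁ best
    b<p = proj₁ (proj₁ (proj₂ best))
    ap = proj₂ (proj₁ (proj₂ best))
    bp-uncrossed : ∀ t → T ∋ t → ¬ Crosses (b , p) t
    bp-uncrossed (x , y) Txy bp⋈xy with Triangle.across-pb a b p a<b b<p x y (diagonal-≤ _ (tri-diagonal tT _ Txy))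
      (uncrossed ap x y Txy) (tri-noncrossing tT (x , y) (a , b) Txy Tab) (crosses-sym (b , p) (x , y) bp⋈xy)
    ... | refl , b<y , y<p = <⇒≱ y<p (proj₂ (proj₂ best) y (b<y , inj₁ Txy))
  ... | no none = p , inj₂ (p<a , pa , uncrossed⇒InOrSide tT (p , b) (<-trans p<a a<b) pb-uncrossed)
    where
    a<b = diagonal-< (a , b) (tri-diagonal tT (a , b) Tab)
    a≢0 : toℕ a ≢ 0
    a≢0 a≡0 = none (last , b<last , inj₂ (inj₂ (a≡0 , 1+last≡n)))
      where
      1+[n∸1]≡n : suc (n ∸ 1) ≡ n
      1+[n∸1]≡n = m+[n∸m]≡n {1} {n} (≤-trans (s≤s z≤n) (FP.toℕ<n b))
      last : Fin n
      last = fromℕ< (subst (n ∸ 1 <_) 1+[n∸1]≡n ≤-refl)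
      1+last≡n : suc (toℕ last) ≡ n
      1+last≡n = trans (cong suc (FP.toℕ-fromℕ< _)) 1+[n∸1]≡n
      b<last : toℕ b < toℕ last
      b<last = subst (toℕ b <_) (sym (FP.toℕ-fromℕ< _))
        (∸-monoˡ-≤ 1 (≤∧≢⇒< (FP.toℕ<n b) (λ 1+b≡n → proj₂ (tri-diagonal tT (a , b) Tab) (a≡0 , 1+b≡n))))
    a-1 : Fin n
    a-1 = fromℕ< (≤-<-trans (m∸n≤m (toℕ a) 1) (FP.toℕ<n a))
    a≡1+[a-1] : toℕ a ≡ suc (toℕ a-1)
    a≡1+[a-1] = trans (sym (m+[n∸m]≡n {1} {toℕ a} (≤∧≢⇒< z≤n (a≢0 ∘ sym)))) (cong suc (sym (FP.toℕ-fromℕ< _)))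
    best = least (λ q → (toℕ q < toℕ a) × InOrSide T (q , a)) (λ q → toℕ q <? toℕ a ×-dec inOrSide? (q , a))
      (a-1 , subst (toℕ a-1 <_) (sym a≡1+[a-1]) ≤-refl , inj₂ (inj₁ a≡1+[a-1]))
    p = proj₁ best
    p<a = proj₁ (proj₁ (proj₂ best))
    pa = proj₂ (proj₁ (proj₂ best))
    pb-uncrossed : ∀ t → T ∋ t → ¬ Crosses (p , b) t
    pb-uncrossed (x , y) Txy pb⋈xy with Triangle.across-ab p a b p<a a<b x y (diagonal-≤ _ (tri-diagonal tT _ Txy))
      (tri-noncrossing tT (x , y) (a , b) Txy Tab) (uncrossed pa x y Txy) (crosses-sym (p , b) (x , y) pb⋈xy)
    ... | inj₁ (refl , b<y) = none (y , b<y , inj₁ Txy)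
    ... | inj₂ (refl , x<p) = <⇒≱ x<p (proj₂ (proj₂ best) x (<-trans x<p p<a , inj₁ Txy))

module PentagonFans {n : ℕ} (5≤n : 5 ≤ n) {X Y W : DiagSet n} (tX : Tri X) (tY : Tri Y) (W⊆X : W ⊆ X) (W⊆Y : W ⊆ Y)
  (∣W∣ : size W ≡ n ∸ 5) (v₀ v₁ v₂ v₃ v₄ : Fin n)
  (v₀<v₁ : toℕ v₀ < toℕ v₁) (v₁<v₂ : toℕ v₁ < toℕ v₂) (v₂<v₃ : toℕ v₂ < toℕ v₃) (v₃<v₄ : toℕ v₃ < toℕ v₄) where
  open ConvexPentagon 5≤n v₀ v₁ v₂ v₃ v₄ v₀<v₁ v₁<v₂ v₂<v₃ v₃<v₄ tX W⊆X ∣W∣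

  forward : ∀ s → X ∋ diag s → X ∋ diag (next s) → ¬ (W ∋ diag s) → ¬ (W ∋ diag (next s)) → (∀ k → InOrSide X (edge k)) →
    Y ∋ diag (next s) → Y ∋ diag (next (next s)) → FiveCycleThrough n X Y
  forward s Xs Xs′ W∌s W∌s′ edges Ys′ Ys″ =
    cycle-cong (fan s) X (fan (next s)) Y (same-sym X (fan s) (fan-unique tX W⊆X s Xs Xs′))
      (same-sym Y (fan (next s)) (fan-unique tY W⊆Y (next s) Ys′ Ys″)) (FiveCycle.through fans s)
    where open Fan s Xs Xs′ W∌s W∌s′ edges

  backward : ∀ s → X ∋ diag (next s) → X ∋ diag (next (next s)) → ¬ (W ∋ diag (next s)) → ¬ (W ∋ diag (next (next s))) →
    (∀ k → InOrSide X (edge k)) → Y ∋ diag s → Y ∋ diag (next s) → FiveCycleThrough n X Y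
  backward s Xs′ Xs″ W∌s′ W∌s″ edges Ys Ys′ =
    cycle-cong (fan (next s)) X (fan s) Y (same-sym X (fan (next s)) (fan-unique tX W⊆X (next s) Xs′ Xs″))
      (same-sym Y (fan s) (fan-unique tY W⊆Y s Ys Ys′)) (cycle-reverse (fan s) (fan (next s)) (FiveCycle.through fans s))
    where open Fan (next s) Xs′ Xs″ W∌s′ W∌s″ edges

module _ {n : ℕ} where
  inOrSide-mono : {S X : DiagSet n} → S ⊆ X → ∀ e → InOrSide S e → InOrSide X e
  inOrSide-mono S⊆X e (inj₁ Se) = inj₁ (S⊆X _ _ Se)
  inOrSide-mono S⊆X e (inj₂ side) = inj₂ side

-- X and Y differ by flipping the diagonals of the quadrilateral a < b < c < e, whose sides
-- are chords of S = X ∩ Y or of the polygon.  A side σ in S is a side of a triangle of X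
-- outside the quadrilateral; with its apex the quadrilateral becomes a pentagon of which
-- X and Y are consecutive fans over W = S - σ.
module FlipCycle {n : ℕ} (5≤n : 5 ≤ n) {X Y S : DiagSet n} (tX : Tri X) (tY : Tri Y) (S⊆X : S ⊆ X) (S⊆Y : S ⊆ Y)
  (∣S∣ : size S ≡ n ∸ 4) (a b c e : Fin n) (a<b : toℕ a < toℕ b) (b<c : toℕ b < toℕ c) (c<e : toℕ c < toℕ e)
  (X∋ac : X ∋ (a , c)) (Y∋be : Y ∋ (b , e)) (S∌ac : ¬ (S ∋ (a , c))) (S∌be : ¬ (S ∋ (b , e)))
  (sides : ∀ r → InOrSide S (Quadrilateral.side a b c e a<b b<c c<e r)) where

  private
    module Without (σ : Chord n) (Sσ : S ∋ σ) where
      W : DiagSet n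
      W = S ─ σ
      ∣W∣ : size W ≡ n ∸ 5
      ∣W∣ = suc-injective (trans (sym (size-remove S σ Sσ)) (trans ∣S∣ (∸-suc n 4 5≤n)))
      W⊆X : W ⊆ X
      W⊆X i j h = S⊆X i j (─-elim S σ i j h)
      W⊆Y : W ⊆ Y
      W⊆Y i j h = S⊆Y i j (─-elim S σ i j h)
      W∌σ : ¬ (W ∋ σ)
      W∌σ h = ─-elim≢ S σ _ _ h refl
      W∌ : ∀ {t} → ¬ (S ∋ t) → ¬ (W ∋ t)
      W∌ S∌t h = S∌t (─-elim S σ _ _ h)

    open Quadrilateral a b c e a<b b<c c<e using () renaming (side to quadSide)

    side : ∀ r → InOrSide X (quadSide r)
    side r = inOrSide-mono S⊆X _ (sides r)

    open TrianglesOn tX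

  via-ab : S ∋ (a , b) → FiveCycleThrough n X Y
  via-ab Sσ with inner a b (S⊆X _ _ Sσ)
  ... | p , a<p , p<b , ap , pb = PentagonFans.backward 5≤n tX tY W⊆X W⊆Y ∣W∣ a p b c e a<p p<b b<c c<e (fs (fs (fs (fs fz))))
    (S⊆X _ _ Sσ) X∋ac W∌σ (W∌ S∌ac) edges Y∋be (S⊆Y _ _ Sσ)
    where
    open Without (a , b) Sσ
    edges : ∀ k → InOrSide X _
    edges = λ { fz → ap ; (fs fz) → pb ; (fs (fs fz)) → side (fs fz) ; (fs (fs (fs fz))) → side (fs (fs fz)) ; (fs (fs (fs (fs fz)))) → side (fs (fs (fs fz))) }

  via-bc : S ∋ (b , c) → FiveCycleThrough n X Y
  via-bc Sσ with inner b c (S⊆X _ _ Sσ)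
  ... | p , b<p , p<c , bp , pc = PentagonFans.forward 5≤n tX tY W⊆X W⊆Y ∣W∣ a b p c e a<b b<p p<c c<e (fs fz)
    X∋ac (S⊆X _ _ Sσ) (W∌ S∌ac) W∌σ edges (S⊆Y _ _ Sσ) Y∋be
    where
    open Without (b , c) Sσ
    edges : ∀ k → InOrSide X _
    edges = λ { fz → side fz ; (fs fz) → bp ; (fs (fs fz)) → pc ; (fs (fs (fs fz))) → side (fs (fs fz)) ; (fs (fs (fs (fs fz)))) → side (fs (fs (fs fz))) }

  via-ce : S ∋ (c , e) → FiveCycleThrough n X Y
  via-ce Sσ with inner c e (S⊆X _ _ Sσ)
  ... | p , c<p , p<e , cp , pe = PentagonFans.backward 5≤n tX tY W⊆X W⊆Y ∣W∣ a b c p e a<b b<c c<p p<e (fs (fs (fs fz)))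
    (S⊆X _ _ Sσ) X∋ac W∌σ (W∌ S∌ac) edges Y∋be (S⊆Y _ _ Sσ)
    where
    open Without (c , e) Sσ
    edges : ∀ k → InOrSide X _
    edges = λ { fz → side fz ; (fs fz) → side (fs fz) ; (fs (fs fz)) → cp ; (fs (fs (fs fz))) → pe ; (fs (fs (fs (fs fz)))) → side (fs (fs (fs fz))) }

  via-ae : S ∋ (a , e) → FiveCycleThrough n X Y
  via-ae Sσ with outer a e (S⊆X _ _ Sσ)
  ... | p , inj₁ (e<p , ap , ep) = PentagonFans.forward 5≤n tX tY W⊆X W⊆Y ∣W∣ a b c e p a<b b<c c<e e<p fz
    X∋ac (S⊆X _ _ Sσ) (W∌ S∌ac) W∌σ edges (S⊆Y _ _ Sσ) Y∋be
    where
    open Without (a , e) Sσ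
    edges : ∀ k → InOrSide X _
    edges = λ { fz → side fz ; (fs fz) → side (fs fz) ; (fs (fs fz)) → side (fs (fs fz)) ; (fs (fs (fs fz))) → ep ; (fs (fs (fs (fs fz)))) → ap }
  ... | p , inj₂ (p<a , pa , pe) = PentagonFans.forward 5≤n tX tY W⊆X W⊆Y ∣W∣ p a b c e p<a a<b b<c c<e (fs (fs fz))
    X∋ac (S⊆X _ _ Sσ) (W∌ S∌ac) W∌σ edges (S⊆Y _ _ Sσ) Y∋be
    where
    open Without (a , e) Sσ
    edges : ∀ k → InOrSide X _
    edges = λ { fz → pa ; (fs fz) → side fz ; (fs (fs fz)) → side (fs fz) ; (fs (fs (fs fz))) → side (fs (fs fz)) ; (fs (fs (fs (fs fz)))) → pe }

  -- The four sides of a quadrilateral are sides of the polygon only if n = 4.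
  not-all-sides : Side (a , b) → Side (b , c) → Side (c , e) → Side (a , e) → ⊥
  not-all-sides ab bc ce ae = consecutive (inner-side ab (<-trans b<c c<e)) (later-side bc (>⇒≢ (≤-<-trans z≤n a<b)))
                                          (later-side ce (>⇒≢ (≤-<-trans z≤n (<-trans a<b b<c)))) ae
    where
    inner-side : ∀ {i j : Fin n} → Side (i , j) → toℕ j < toℕ e → toℕ j ≡ suc (toℕ i)
    inner-side (inj₁ p) _ = p
    inner-side (inj₂ (_ , 1+j≡n)) j<e = ⊥-elim (<-irrefl refl (≤-trans (FP.toℕ<n e) (subst (_≤ toℕ e) 1+j≡n j<e)))
    later-side : ∀ {i j : Fin n} → Side (i , j) → toℕ i ≢ 0 → toℕ j ≡ suc (toℕ i)
    later-side (inj₁ p) _ = p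
    later-side (inj₂ (i≡0 , _)) i≢0 = ⊥-elim (i≢0 i≡0)
    consecutive : toℕ b ≡ suc (toℕ a) → toℕ c ≡ suc (toℕ b) → toℕ e ≡ suc (toℕ c) → Side (a , e) → ⊥
    consecutive b≡ c≡ e≡ (inj₁ e≡′) = 1+x≢3+x (trans (sym e≡′) (trans e≡ (cong suc (trans c≡ (cong suc b≡)))))
      where
      1+x≢3+x : ∀ {x} → suc x ≢ suc (suc (suc x))
      1+x≢3+x {x} p = <-irrefl p (≤-trans (n<1+n (suc x)) (n≤1+n (suc (suc x))))
    consecutive b≡ c≡ e≡ (inj₂ (a≡0 , 1+e≡n)) = <-irrefl (sym n≡4) 5≤n
      where
      n≡4 : n ≡ 4
      n≡4 = trans (sym 1+e≡n) (cong suc (trans e≡ (cong suc (trans c≡ (cong suc (trans b≡ (cong suc a≡0)))))))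

  cycle : FiveCycleThrough n X Y
  cycle with sides fz | sides (fs fz) | sides (fs (fs fz)) | sides (fs (fs (fs fz)))
  ... | inj₁ Sab | _ | _ | _ = via-ab Sab
  ... | inj₂ _ | inj₁ Sbc | _ | _ = via-bc Sbc
  ... | inj₂ _ | inj₂ _ | inj₁ Sce | _ = via-ce Sce
  ... | inj₂ _ | inj₂ _ | inj₂ _ | inj₁ Sae = via-ae Sae
  ... | inj₂ ab | inj₂ bc | inj₂ ce | inj₂ ae = ⊥-elim (not-all-sides ab bc ce ae)

-- The 5-cycles through an edge

module Flip {n : ℕ} (5≤n : 5 ≤ n) {T U : DiagSet n} (adj : Adjacent n T U) where
  4≤n : 4 ≤ n
  4≤n = ≤-trans (n≤1+n 4) 5≤n

  m : ℕ
  m = n ∸ 5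

  n∸4≡1+m : n ∸ 4 ≡ suc m
  n∸4≡1+m = ∸-suc n 4 5≤n

  n∸3≡2+m : n ∸ 3 ≡ suc (suc m)
  n∸3≡2+m = trans (∸-suc n 3 4≤n) (cong suc n∸4≡1+m)

  tT : Tri T
  tT = adj-triˡ adj

  tU : Tri U
  tU = adj-triʳ adj

  T≢U : ¬ SameSet T U
  T≢U = adj-≢ adj

  S : DiagSet n
  S = T ∩ U

  S⊆T : S ⊆ T
  S⊆T = ∩-elimˡ T U

  S⊆U : S ⊆ U
  S⊆U = ∩-elimʳ T U

  ∣S∣ : size S ≡ n ∸ 4
  ∣S∣ = adj-size adj

  oT : OneMore T S
  oT = oneMore 4≤n tT S⊆T ∣S∣

  oU : OneMore U S
  oU = oneMore 4≤n tU S⊆U ∣S∣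

  open OneMore oT public using () renaming (extra to d; extra∈ to d∈T; extra∉ to d∉S)
  open OneMore oU public using () renaming (extra to d′; extra∈ to d′∈U; extra∉ to d′∉S)

  d′∉T : ¬ (T ∋ d′)
  d′∉T h = d′∉S (∩-intro T U d′ h d′∈U)

  opaque
    d′⋈d : Crosses d′ d
    d′⋈d = extra-crossed tT oT d′ (tri-diagonal tU d′ d′∈U) d′∉S (λ p → d′∉T (∋-subst {X = T} (sym p) d∈T))
      (λ t St → tri-noncrossing tU d′ t d′∈U (S⊆U _ _ St))

  not-both : {X : DiagSet n} → Tri X → X ∋ d → X ∋ d′ → ⊥
  not-both tX Xd Xd′ = tri-noncrossing tX d′ d Xd′ Xd d′⋈d

  splitT : ∀ x → T ∋ x → (S ∋ x) ⊎ (x ≡ d)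
  splitT = oneMore-split oT

  splitU : ∀ x → U ∋ x → (S ∋ x) ⊎ (x ≡ d′)
  splitU = oneMore-split oU

  open AroundFlip tU oU d′⋈d (λ t St → tri-noncrossing tT t d (S⊆T _ _ St) d∈T) public
    renaming (a to qa; b to qb; c to qc; e to qe)

  sides-in-S : ∀ r → InOrSide S (side r)
  sides-in-S r = [ (λ Us → [ inj₁ , (λ p → ⊥-elim (side≢x r p)) ]′ (splitU (side r) Us)) , inj₂ ]′ (sides-InOrSide r)

  side? : (σ : Chord n) → Dec (∃ λ r → σ ≡ side r)
  side? σ = FP.any? (λ r → σ ≟ᶜ side r)

  outside : (P Q : DiagSet n) → size P ≡ suc m → size (P ∩ Q) ≤ m → ∃ λ x → (P ∋ x) × ¬ (Q ∋ x)
  outside P Q ∣P∣ ∣P∩Q∣ = size-gap P Q (subst (size (P ∩ Q) <_) (sym ∣P∣) (s≤s ∣P∩Q∣))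

  -- A 5-cycle T – U – A – B – C – T: U → A flips e to e′, and C → T flips f′ to f.
  -- Then e = f is a chord of S and a side of the quadrilateral of d and d′, and the
  -- cycle is the one obtained by flipping around the pentagon that side closes up.
  module OnCycle (cy : FiveCycleThrough n T U) where
    open FiveCycleThrough cy

    tA : Tri A
    tA = adj-triʳ adjUA
    tB : Tri B
    tB = adj-triʳ adjAB
    tC : Tri C
    tC = adj-triʳ adjBC

    oUA : OneMore U (U ∩ A)
    oUA = oneMore 4≤n tU (∩-elimˡ U A) (adj-size adjUA)
    oAU : OneMore A (U ∩ A)
    oAU = oneMore 4≤n tA (∩-elimʳ U A) (adj-size adjUA)
    oTC : OneMore T (C ∩ T)
    oTC = oneMore 4≤n tT (∩-elimʳ C T) (adj-size adjCT)
    oCT : OneMore C (C ∩ T)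
    oCT = oneMore 4≤n tC (∩-elimˡ C T) (adj-size adjCT)

    open OneMore oUA public using () renaming (extra to e; extra∈ to e∈U)
    open OneMore oAU public using () renaming (extra to e′; extra∈ to e′∈A)
    open OneMore oTC public using () renaming (extra to f; extra∈ to f∈T)
    open OneMore oCT public using () renaming (extra to f′; extra∈ to f′∈C)

    e∉A : ¬ (A ∋ e)
    e∉A h = OneMore.extra∉ oUA (∩-intro U A e e∈U h)
    e′∉U : ¬ (U ∋ e′)
    e′∉U h = OneMore.extra∉ oAU (∩-intro U A e′ h e′∈A)
    f∉C : ¬ (C ∋ f)
    f∉C h = OneMore.extra∉ oTC (∩-intro C T f h f∈T)
    f′∉T : ¬ (T ∋ f′)
    f′∉T h = OneMore.extra∉ oCT (∩-intro C T f′ f′∈C h)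

    U⇒A : ∀ x → U ∋ x → x ≢ e → A ∋ x
    U⇒A x Ux x≢e = [ ∩-elimʳ U A _ _ , ⊥-elim ∘ x≢e ]′ (oneMore-split oUA x Ux)
    A⇒U : ∀ x → A ∋ x → (U ∋ x) ⊎ (x ≡ e′)
    A⇒U x Ax = [ inj₁ ∘ ∩-elimˡ U A _ _ , inj₂ ]′ (oneMore-split oAU x Ax)
    T⇒C : ∀ x → T ∋ x → x ≢ f → C ∋ x
    T⇒C x Tx x≢f = [ ∩-elimˡ C T _ _ , ⊥-elim ∘ x≢f ]′ (oneMore-split oTC x Tx)
    C⇒T : ∀ x → C ∋ x → (T ∋ x) ⊎ (x ≡ f′)
    C⇒T x Cx = [ inj₁ ∘ ∩-elimʳ C T _ _ , inj₂ ]′ (oneMore-split oCT x Cx)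

    -- Otherwise T, U and A (resp. T, U and C) would be three triangulations containing S.
    e∈S : S ∋ e
    e∈S = [ id , (λ e≡d′ → ⊥-elim (at-most-two 4≤n tT tU tA S⊆T S⊆U (S⊆A e≡d′) ∣S∣ T≢U T≢A (adj-≢ adjUA))) ]′ (splitU e e∈U)
      where
      S⊆A : e ≡ d′ → S ⊆ A
      S⊆A e≡d′ i j h = U⇒A (i , j) (S⊆U i j h) (λ p → d′∉S (∋-subst {X = S} (trans p e≡d′) h))
    f∈S : S ∋ f
    f∈S = [ id , (λ f≡d → ⊥-elim (at-most-two 4≤n tT tU tC S⊆T S⊆U (S⊆C f≡d) ∣S∣ T≢U (adj-≢′ adjCT) U≢C)) ]′ (splitT f f∈T)
      where
      S⊆C : f ≡ d → S ⊆ C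
      S⊆C f≡d i j h = T⇒C (i , j) (S⊆T i j h) (λ p → d∉S (∋-subst {X = S} (trans p f≡d) h))

    d′∈A : A ∋ d′
    d′∈A = U⇒A d′ d′∈U (λ p → d′∉S (∋-subst {X = S} (sym p) e∈S))
    d∈C : C ∋ d
    d∈C = T⇒C d d∈T (λ p → d∉S (∋-subst {X = S} (sym p) f∈S))

    e′∉T : ¬ (T ∋ e′)
    e′∉T h = [ e′∉U ∘ S⊆U _ _ , (λ p → not-both tA (∋-subst {X = A} p e′∈A) d′∈A) ]′ (splitT e′ h)
    f′∉U : ¬ (U ∋ f′)
    f′∉U h = [ f′∉T ∘ S⊆T _ _ , (λ p → not-both tC d∈C (∋-subst {X = C} p f′∈C)) ]′ (splitU f′ h)

    A∩C-cases : ∀ x → A ∋ x → C ∋ x → ((S ∋ x) × (x ≢ e) × (x ≢ f)) ⊎ ((x ≡ e′) × (x ≡ f′))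
    A∩C-cases x Ax Cx with A⇒U x Ax | C⇒T x Cx
    ... | inj₁ Ux | inj₁ Tx = inj₁ (∩-intro T U x Tx Ux , (λ p → e∉A (∋-subst {X = A} p Ax)) , (λ p → f∉C (∋-subst {X = C} p Cx)))
    ... | inj₁ Ux | inj₂ p = ⊥-elim (f′∉U (∋-subst {X = U} p Ux))
    ... | inj₂ p | inj₁ Tx = ⊥-elim (e′∉T (∋-subst {X = T} p Tx))
    ... | inj₂ p | inj₂ q = inj₂ (p , q)

    D : DiagSet n
    D = (B ∩ A) ∩ (B ∩ C)
    D⊆B : D ⊆ B
    D⊆B i j h = ∩-elimˡ B A i j (∩-elimˡ (B ∩ A) (B ∩ C) i j h)
    D⊆A : D ⊆ A
    D⊆A i j h = ∩-elimʳ B A i j (∩-elimˡ (B ∩ A) (B ∩ C) i j h)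
    D⊆C : D ⊆ C
    D⊆C i j h = ∩-elimʳ B C i j (∩-elimʳ (B ∩ A) (B ∩ C) i j h)

    ∣B∩A∣ : size (B ∩ A) ≡ suc m
    ∣B∩A∣ = trans (size-cong _ _ (∩-comm B A)) (trans (adj-size adjAB) n∸4≡1+m)
    ∣B∩C∣ : size (B ∩ C) ≡ suc m
    ∣B∩C∣ = trans (adj-size adjBC) n∸4≡1+m

    -- Inclusion–exclusion inside B: (m + 1) + (m + 1) ≤ (m + 2) + |D|.
    m≤∣D∣ : m ≤ size D
    m≤∣D∣ = +-cancelˡ-≤ m m (size D) (≤-pred (≤-pred (subst₂ _≤_ lhs (cong (_+ size D) (trans (tri-size tB) n∸3≡2+m))
              (size-inclusion-exclusion B (B ∩ A) (B ∩ C) (∩-elimˡ B A) (∩-elimˡ B C)))))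
      where
      lhs : size (B ∩ A) + size (B ∩ C) ≡ suc (suc (m + m))
      lhs = trans (cong₂ _+_ ∣B∩A∣ ∣B∩C∣) (cong suc (+-suc m m))

    -- If e ≢ f, then e′ ≡ f′ would be compatible with all of T, and e′ ≢ f′ would squeeze D into S - e - f.
    e≡f : e ≡ f
    e≡f with e ≟ᶜ f
    ... | yes p = p
    ... | no e≢f with e′ ≟ᶜ f′
    ...   | yes e′≡f′ = ⊥-elim (e′∉T (tri-maximal tT e′ (tri-diagonal tA e′ e′∈A) e′-uncrossed))
      where
      e′-uncrossed : ∀ t → T ∋ t → ¬ Crosses e′ t
      e′-uncrossed t Tt with splitT t Tt
      ... | inj₂ t≡d = tri-noncrossing tC e′ t (∋-subst {X = C} (sym e′≡f′) f′∈C) (∋-subst {X = C} (sym t≡d) d∈C)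
      ... | inj₁ St with t ≟ᶜ e
      ...   | yes t≡e = tri-noncrossing tC e′ t (∋-subst {X = C} (sym e′≡f′) f′∈C) (T⇒C t (S⊆T _ _ St) (λ t≡f → e≢f (trans (sym t≡e) t≡f)))
      ...   | no t≢e = tri-noncrossing tA e′ t e′∈A (U⇒A t (S⊆U _ _ St) t≢e)
    ...   | no e′≢f′ = ⊥-elim (<-irrefl refl (subst (_≤ size ((S ─ e) ─ f)) m≡ (≤-trans m≤∣D∣ (size-mono D ((S ─ e) ─ f) D⊆))))
      where
      D⊆ : D ⊆ ((S ─ e) ─ f)
      D⊆ i j h with A∩C-cases (i , j) (D⊆A i j h) (D⊆C i j h)
      ... | inj₁ (Sx , x≢e , x≢f) = ─-intro (S ─ e) f (i , j) (─-intro S e (i , j) Sx x≢e) x≢f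
      ... | inj₂ (x≡e′ , x≡f′) = ⊥-elim (e′≢f′ (trans (sym x≡e′) x≡f′))
      m≡ : m ≡ suc (size ((S ─ e) ─ f))
      m≡ = suc-injective (trans (sym n∸4≡1+m) (trans (sym ∣S∣)
             (trans (size-remove S e e∈S) (cong suc (size-remove (S ─ e) f (─-intro S e f f∈S (e≢f ∘ sym)))))))

    S₀ : DiagSet n
    S₀ = S ─ e
    ∣S₀∣ : size S₀ ≡ m
    ∣S₀∣ = suc-injective (trans (sym (size-remove S e e∈S)) (trans ∣S∣ n∸4≡1+m))
    S₀⊆S : S₀ ⊆ S
    S₀⊆S = ─-elim S e
    S₀⊆A : S₀ ⊆ A
    S₀⊆A i j h = U⇒A (i , j) (S⊆U i j (S₀⊆S i j h)) (─-elim≢ S e i j h)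
    S₀⊆C : S₀ ⊆ C
    S₀⊆C i j h = T⇒C (i , j) (S⊆T i j (S₀⊆S i j h)) (λ p → ─-elim≢ S e i j h (trans p (sym e≡f)))
    S₀⊆T : S₀ ⊆ T
    S₀⊆T i j h = S⊆T i j (S₀⊆S i j h)
    S₀⊆U : S₀ ⊆ U
    S₀⊆U i j h = S⊆U i j (S₀⊆S i j h)

    size-S₀⊕ : ∀ x → ¬ (S ∋ x) ⊎ ¬ (U ∋ x) → size (S₀ ⊕ x) ≡ n ∸ 4
    size-S₀⊕ x x∉ = trans (size-insert S₀ x ∉S₀) (trans (cong suc ∣S₀∣) (sym n∸4≡1+m))
      where
      ∉S₀ : ¬ (S₀ ∋ x)
      ∉S₀ h = [ (λ ¬S → ¬S (S₀⊆S _ _ h)) , (λ ¬U → ¬U (S₀⊆U _ _ h)) ]′ x∉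

    A∖C : e′ ≡ f′ → ∀ x → A ∋ x → ¬ (C ∋ x) → x ≡ d′
    A∖C e′≡f′ x Ax ¬Cx with A⇒U x Ax
    ... | inj₂ x≡e′ = ⊥-elim (¬Cx (∋-subst {X = C} (sym (trans x≡e′ e′≡f′)) f′∈C))
    ... | inj₁ Ux = [ (λ Sx → ⊥-elim (¬Cx (T⇒C x (S⊆T _ _ Sx) (λ x≡f → e∉A (∋-subst {X = A} (trans x≡f (sym e≡f)) Ax))))) , id ]′ (splitU x Ux)
    C∖A : e′ ≡ f′ → ∀ x → C ∋ x → ¬ (A ∋ x) → x ≡ d
    C∖A e′≡f′ x Cx ¬Ax with C⇒T x Cx
    ... | inj₂ x≡f′ = ⊥-elim (¬Ax (∋-subst {X = A} (sym (trans x≡f′ (sym e′≡f′))) e′∈A))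
    ... | inj₁ Tx = [ (λ Sx → ⊥-elim (¬Ax (U⇒A x (S⊆U _ _ Sx) (λ x≡e → f∉C (∋-subst {X = C} (trans x≡e e≡f) Cx))))) , id ]′ (splitT x Tx)

    W₁ : DiagSet n
    W₁ = S₀ ⊕ e′
    W₁⊆A : W₁ ⊆ A
    W₁⊆A = ⊕-⊆ S₀ A e′ S₀⊆A e′∈A
    D⊆W₁ : D ⊆ W₁
    D⊆W₁ i j h with A∩C-cases (i , j) (D⊆A i j h) (D⊆C i j h)
    ... | inj₁ (Sx , x≢e , _) = ⊕-old S₀ e′ i j (─-intro S e (i , j) Sx x≢e)
    ... | inj₂ (x≡e′ , _) = ∋-subst {X = W₁} (sym x≡e′) (⊕-new S₀ e′)

    -- If e′ ≡ f′, then either A, B, C all contain W₁, or D is too small and B contains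
    -- both a chord of A ∖ C (namely d′) and one of C ∖ A (namely d).
    e′≢f′ : e′ ≢ f′
    e′≢f′ e′≡f′ with ⊆-or-witness W₁ B
    ... | inj₁ W₁⊆B = at-most-two 4≤n tA tC tB W₁⊆A (⊕-⊆ S₀ C e′ S₀⊆C (∋-subst {X = C} (sym e′≡f′) f′∈C)) W₁⊆B
                        (size-S₀⊕ e′ (inj₂ e′∉U)) A≢C (adj-≢ adjAB) (adj-≢′ adjBC)
    ... | inj₂ (w , W₁w , ¬Bw) = not-both tB (∋-subst {X = B} (C∖A e′≡f′ y (∩-elimʳ B C _ _ By) (λ Ay → y∉ (∩-intro B A y (∩-elimˡ B C _ _ By) Ay)))
                                                       (∩-elimˡ B C _ _ By))
                                            (∋-subst {X = B} (A∖C e′≡f′ x (∩-elimʳ B A _ _ Bx) (λ Cx → x∉ (∩-intro B C x (∩-elimˡ B A _ _ Bx) Cx)))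
                                                       (∩-elimˡ B A _ _ Bx))
      where
      ∣D∣≤m : size D ≤ m
      ∣D∣≤m = subst (size D ≤_) (suc-injective (trans (sym (size-remove W₁ w W₁w)) (trans (size-S₀⊕ e′ (inj₂ e′∉U)) n∸4≡1+m)))
                (size-mono D (W₁ ─ w) (λ i j h → ─-intro W₁ w (i , j) (D⊆W₁ i j h) (λ p → ¬Bw (∋-subst {X = B} p (D⊆B i j h)))))
      BA∖BC = outside (B ∩ A) (B ∩ C) ∣B∩A∣ ∣D∣≤m
      BC∖BA = outside (B ∩ C) (B ∩ A) ∣B∩C∣ (subst (_≤ m) (size-cong _ _ (∩-comm (B ∩ A) (B ∩ C))) ∣D∣≤m)
      x = proj₁ BA∖BC
      Bx = proj₁ (proj₂ BA∖BC)
      x∉ = proj₂ (proj₂ BA∖BC)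
      y = proj₁ BC∖BA
      By = proj₁ (proj₂ BC∖BA)
      y∉ = proj₂ (proj₂ BC∖BA)

    D⊆S₀ : D ⊆ S₀
    D⊆S₀ i j h with A∩C-cases (i , j) (D⊆A i j h) (D⊆C i j h)
    ... | inj₁ (Sx , x≢e , _) = ─-intro S e (i , j) Sx x≢e
    ... | inj₂ (x≡e′ , x≡f′) = ⊥-elim (e′≢f′ (trans (sym x≡e′) x≡f′))

    S₀⊆B : S₀ ⊆ B
    S₀⊆B i j h = D⊆B i j (size-≤⇒⊇ D S₀ D⊆S₀ (subst (_≤ size D) (sym ∣S₀∣) m≤∣D∣) i j h)

    W₃ : DiagSet n
    W₃ = S₀ ⊕ d
    W₃⊆T : W₃ ⊆ T
    W₃⊆T = ⊕-⊆ S₀ T d S₀⊆T d∈T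
    W₃⊆C : W₃ ⊆ C
    W₃⊆C = ⊕-⊆ S₀ C d S₀⊆C d∈C

    ∣S₀∩∣≤m : (P : DiagSet n) → size (P ∩ S₀) ≤ m
    ∣S₀∩∣≤m P = subst (size (P ∩ S₀) ≤_) ∣S₀∣ (size-mono (P ∩ S₀) S₀ (∩-elimʳ P S₀))

    -- B has a chord of A outside S₀; it cannot be a chord of U (by at-most-two over S₀ + d′), so it is e′.
    e′∈B : B ∋ e′
    e′∈B = let u , BAu , ¬S₀u = outside (B ∩ A) S₀ ∣B∩A∣ (∣S₀∩∣≤m (B ∩ A)) in
      ∋-subst {X = B} (is-e′ u (∩-elimˡ B A _ _ BAu) (∩-elimʳ B A _ _ BAu) ¬S₀u) (∩-elimˡ B A _ _ BAu)
      where
      is-e′ : ∀ u → B ∋ u → A ∋ u → ¬ (S₀ ∋ u) → u ≡ e′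
      is-e′ u Bu Au ¬S₀u with A⇒U u Au
      ... | inj₂ u≡e′ = u≡e′
      ... | inj₁ Uu with splitU u Uu
      ...   | inj₂ u≡d′ = ⊥-elim (at-most-two 4≤n tU tA tB (⊕-⊆ S₀ U d′ S₀⊆U d′∈U) (⊕-⊆ S₀ A d′ S₀⊆A d′∈A)
                            (⊕-⊆ S₀ B d′ S₀⊆B (∋-subst {X = B} u≡d′ Bu)) (size-S₀⊕ d′ (inj₁ d′∉S)) (adj-≢ adjUA) U≢B (adj-≢ adjAB))
      ...   | inj₁ Su = ⊥-elim (¬S₀u (─-intro S e u Su (λ p → e∉A (∋-subst {X = A} p Au))))

    -- The flipped chord e is a side of the quadrilateral: otherwise e′ would be compatible with
    -- W₃ = S₀ + d, giving a third triangulation W₃ + e′ over W₃ besides T and C.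
    not-a-side : (∀ r → side r ≢ e) → ⊥
    not-a-side ≢side = at-most-two 4≤n tT tC tT′ W₃⊆T W₃⊆C (⊕-old W₃ e′) (size-S₀⊕ d (inj₁ d∉S)) (adj-≢′ adjCT) T≢T′ C≢T′
      where
      e′-noSides : NoSides e′
      e′-noSides r = [ (λ Ss → tri-noncrossing tA e′ (side r) e′∈A (S₀⊆A _ _ (─-intro S e (side r) Ss (≢side r))))
                     , side-uncrossed (side r) e′ ]′ (sides-in-S r)
      e′⋈̸d : ¬ Crosses e′ d
      e′⋈̸d c = e′∉U (∋-subst {X = U} (sym (crossing-y e′ (diagonal-≤ e′ (tri-diagonal tA e′ e′∈A)) e′-noSides c)) d′∈U)
      e′∉W₃ : ¬ (W₃ ∋ e′)
      e′∉W₃ h = [ (λ p → e′∉T (∋-subst {X = T} (sym p) d∈T)) , (λ S₀e′ → e′∉U (S₀⊆U _ _ S₀e′)) ]′ (⊕-elim S₀ d _ _ h)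
      e′-uncrosses-W₃ : ∀ t → W₃ ∋ t → ¬ Crosses e′ t
      e′-uncrosses-W₃ t h with ⊕-elim S₀ d _ _ h
      ... | inj₁ refl = e′⋈̸d
      ... | inj₂ S₀t = tri-noncrossing tA e′ t e′∈A (S₀⊆A _ _ S₀t)
      tT′ : Tri (W₃ ⊕ e′)
      tT′ = insert-triangulation W₃ (λ x h → tri-diagonal tT x (W₃⊆T _ _ h)) (λ x y hx hy → tri-noncrossing tT x y (W₃⊆T _ _ hx) (W₃⊆T _ _ hy))
              (size-S₀⊕ d (inj₁ d∉S)) 4≤n e′ (tri-diagonal tA e′ e′∈A) e′∉W₃ e′-uncrosses-W₃
      e∉T′ : ¬ ((W₃ ⊕ e′) ∋ e)
      e∉T′ h with ⊕-elim W₃ e′ _ _ h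
      ... | inj₁ p = e′∉U (∋-subst {X = U} p e∈U)
      ... | inj₂ W₃e = [ (λ p → d∉S (∋-subst {X = S} p e∈S)) , (λ S₀e → ─-elim≢ S e _ _ S₀e refl) ]′ (⊕-elim S₀ d _ _ W₃e)
      T≢T′ : ¬ SameSet T (W₃ ⊕ e′)
      T≢T′ same = e∉T′ (trans (sym (same _ _)) (S⊆T _ _ e∈S))
      C≢T′ : ¬ SameSet C (W₃ ⊕ e′)
      C≢T′ same = [ e′∉T , e′≢f′ ]′ (C⇒T e′ (trans (same _ _) (⊕-new W₃ e′)))

    flipped-side : ∃ λ r → e ≡ side r
    flipped-side = case side? e of λ where
      (yes p) → p
      (no ¬side) → ⊥-elim (not-a-side (λ r p → ¬side (r , sym p)))

  same-flip⇒same-cycle : (c₁ c₂ : FiveCycleThrough n T U) → OnCycle.e c₁ ≡ OnCycle.e c₂ → SameCycle c₁ c₂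
  same-flip⇒same-cycle c₁ c₂ eq = sameA , sameB , sameC
    where
    module K₁ = OnCycle c₁
    module K₂ = OnCycle c₂
    module F₁ = FiveCycleThrough c₁
    module F₂ = FiveCycleThrough c₂
    S₀⊆S₀ : K₁.S₀ ⊆ K₂.S₀
    S₀⊆S₀ i j h = ─-intro S K₂.e (i , j) (K₁.S₀⊆S i j h) (λ p → ─-elim≢ S K₁.e i j h (trans p (sym eq)))
    sameA : SameSet F₁.A F₂.A
    sameA = third-equal 4≤n tU K₁.tA K₂.tA (⊕-⊆ K₁.S₀ U d′ K₁.S₀⊆U d′∈U) (⊕-⊆ K₁.S₀ F₁.A d′ K₁.S₀⊆A K₁.d′∈A)
              (⊕-⊆ K₁.S₀ F₂.A d′ (λ i j h → K₂.S₀⊆A i j (S₀⊆S₀ i j h)) K₂.d′∈A) (K₁.size-S₀⊕ d′ (inj₁ d′∉S)) (adj-≢ F₁.adjUA) (adj-≢ F₂.adjUA)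
    sameC : SameSet F₁.C F₂.C
    sameC = third-equal 4≤n tT K₁.tC K₂.tC K₁.W₃⊆T K₁.W₃⊆C
              (⊕-⊆ K₁.S₀ F₂.C d (λ i j h → K₂.S₀⊆C i j (S₀⊆S₀ i j h)) K₂.d∈C) (K₁.size-S₀⊕ d (inj₁ d∉S)) (adj-≢′ F₁.adjCT) (adj-≢′ F₂.adjCT)
    same-e′ : K₁.e′ ≡ K₂.e′
    same-e′ = OneMore.extra-unique K₂.oAU K₁.e′ (trans (sym (sameA _ _)) K₁.e′∈A) (λ h → K₁.e′∉U (∩-elimˡ U F₂.A _ _ h))
    sameB : SameSet F₁.B F₂.B
    sameB = third-equal 4≤n K₁.tA K₁.tB K₂.tB K₁.W₁⊆A (⊕-⊆ K₁.S₀ F₁.B K₁.e′ K₁.S₀⊆B K₁.e′∈B)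
              (⊕-⊆ K₁.S₀ F₂.B K₁.e′ (λ i j h → K₂.S₀⊆B i j (S₀⊆S₀ i j h)) (∋-subst {X = F₂.B} (sym same-e′) K₂.e′∈B))
              (K₁.size-S₀⊕ K₁.e′ (inj₂ K₁.e′∉U)) (adj-≢ F₁.adjAB) (λ s → adj-≢ F₂.adjAB (same-trans F₂.A F₁.A F₂.B (same-sym F₁.A F₂.A sameA) s))

  at-most-four : (cs : List (FiveCycleThrough n T U)) → DistinctCycles cs → length cs ≤ 4
  at-most-four = distinct-length≤ (proj₁ ∘ OnCycle.flipped-side)
    (λ c₁ c₂ r₁≡r₂ → same-flip⇒same-cycle c₁ c₂ (trans (proj₂ (OnCycle.flipped-side c₁)) (trans (cong side r₁≡r₂) (sym (proj₂ (OnCycle.flipped-side c₂))))))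

  at-least-one : FiveCycleThrough n T U
  at-least-one = [ (λ (d′≡ , d≡) → cycle-reverse U T (FlipCycle.cycle 5≤n tU tT S⊆U S⊆T ∣S∣ qa qb qc qe a<b b<c c<e
                       (∋-subst {X = U} d′≡ d′∈U) (∋-subst {X = T} d≡ d∈T) (d′∉S ∘ ∋-subst {X = S} (sym d′≡)) (d∉S ∘ ∋-subst {X = S} (sym d≡)) sides-in-S))
                 , (λ (d′≡ , d≡) → FlipCycle.cycle 5≤n tT tU S⊆T S⊆U ∣S∣ qa qb qc qe a<b b<c c<e
                       (∋-subst {X = T} d≡ d∈T) (∋-subst {X = U} d′≡ d′∈U) (d∉S ∘ ∋-subst {X = S} (sym d≡)) (d′∉S ∘ ∋-subst {X = S} (sym d′≡)) sides-in-S) ]′ orient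

proposition3p3 : (n : ℕ) → 5 ≤ n → (T U : DiagSet n) → Adjacent n T U →
    FiveCycleThrough n T U
    × ((cs : List (FiveCycleThrough n T U)) → DistinctCycles cs → length cs ≤ 4)
proposition3p3 n 5≤n T U adj = Flip.at-least-one 5≤n adj , Flip.at-most-four 5≤n adj
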